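{- Let $\mathcal{M}=(E,\rho)$ be a $q$-matroid of rank $k$ on an $n$-dimensional $\mathbb{F}_q$-vector space $E$, equipped with a non-degenerate symmetric bilinear form, and let $N,D,P,K,F,M$ be the matrices defined in the context. Then: (a) $uN^{\mathsf T}v^{\mathsf T}=R_{\mathcal{M}}(x,y)$, where $u=(y^n,y^{n-1},\dots,1)$ and $v=(y^{ -k},xy^{ -k+1},x^2y^{ -k+2},\dots,x^k)$ (computed in the Laurent polynomial ring); (b) $DPK=N^{\mathsf T}$; (c) $FD=DM$.
   Context: A $q$-matroid on $E$ is $(E,\rho)$ with $\rho$ from subspaces to $\mathbb{N}_0$ satisfying $0\le\rho(V)\le\dim V$, monotonicity and submodularity $\rho(V+W)+\rho(V\cap W)\le\rho(V)+\rho(W)$; rank $k=\rho(E)$. Whitney function $R_{\mathcal{M}}=\sum_{V\le E}x^{k-\rho(V)}y^{\dim V-\rho(V)}$. $[n]_0=\{0,\dots,n\}$; $\mathcal{L}(E)$ is the subspace lattice of $E$ in a fixed order; $V^\perp$ is taken with respect to the given form. $\nu_{i,j}=|\{V\le E:\rho(V)=k-i,\ \dim V=k-i+j\}|$ for $i\in[k]_0$, $j\in[n-k]_0$, and $\nu_{i,b}=0$ for $b\notin[n-k]_0$. Gaussian binomials $\left[{a\atop b}\right]_q$ ($0$ if $b<0$ or $b>a$); $\mu(W,V)=(-1)^{\dim V-\dim W}q^{\binom{\dim V-\dim W}{2}}$ if $W\le V$, else $0$. Matrices: $N=(\nu_{i,n-k+i-j})_{i\in[k]_0,j\in[n]_0}$;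 $D=(\delta_{i,\dim V})_{i\in[n]_0,V\in\mathcal{L}(E)}$; $P=(\delta_{W,V^\perp})_{W,V\in\mathcal{L}(E)}$; $K=(\delta_{k-\rho(V),j})_{V\in\mathcal{L}(E),j\in[k]_0}$; $F=\big((-1)^{i-j}q^{\binom{i-j}{2}}\left[{n-j\atop i-j}\right]_q\big)_{i,j\in[n]_0}$; $M=(M_{V,W})$ with $M_{V,W}=\mu(W,V)$. -}

module Defs where

open import Level using (0ℓ)
open import Data.Bool using (Bool; true; false; _∧_; _∨_; not; if_then_else_; T)
open import Data.Nat as ℕ using (ℕ; zero; suc; _≤_; _≡ᵇ_; _≤ᵇ_; _∸_)
open import Data.Nat.Combinatorics using (_C_)
open import Data.Integer as ℤ using (ℤ; +_)
open import Data.Fin using (Fin; toℕ)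
open import Data.List using (List; []; _∷_; map; foldr; length; filterᵇ; concatMap; allFin; replicate; zipWith; lookup)
open import Data.List.Properties using (≡-dec)
open import Data.Bool.ListAction using (all; any)
open import Data.List.Membership.Propositional using (_∈_)
open import Data.List.Relation.Unary.Unique.Propositional using (Unique)
open import Data.Vec as Vec using (Vec; []; _∷_)
import Data.Vec.Properties as VecP
import Data.Bool.Properties as BoolP
open import Data.Product using (∃; _×_)
open import Relation.Nullary using (does)
open import Relation.Binary.PropositionalEquality using (_≡_; _≢_)
open import Relation.Binary.Definitions using (DecidableEquality)
open import Algebra.Structures using (IsCommutativeRing)
open import Algebra.Bundles using (CommutativeRing)

record FiniteField : Set₁ where
  field
    Carrier : Set
    _≟_ : DecidableEquality Carrier
    _+_ : Carrier → Carrier → Carrier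
    _*_ : Carrier → Carrier → Carrier
    -_  : Carrier → Carrier
    0#  : Carrier
    1#  : Carrier
    isCommutativeRing : IsCommutativeRing _≡_ _+_ _*_ -_ 0# 1#
    0≢1 : 0# ≢ 1#
    inverse : ∀ a → a ≢ 0# → ∃ λ b → a * b ≡ 1#
    elems : List Carrier
    complete : ∀ a → a ∈ elems
    unique : Unique elems

  q : ℕ
  q = length elems

power : {A : Set} → List A → (d : ℕ) → List (Vec A d)
power xs zero    = [] ∷ []
power xs (suc d) = concatMap (λ x → map (x ∷_) (power xs d)) xs

∑ : (m : ℕ) → (Fin m → ℤ) → ℤ
∑ m f = foldr ℤ._+_ (+ 0) (map f (allFin m))

Mat : ℕ → ℕ → Set
Mat a b = Fin a → Fin b → ℤ

_·_ : {a b c : ℕ} → Mat a b → Mat b c → Mat a c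
_·_ {b = b} A B i j = ∑ b (λ l → A i l ℤ.* B l j)

_ᵀ : {a b : ℕ} → Mat a b → Mat b a
(A ᵀ) i j = A j i

δ : ℕ → ℕ → ℤ
δ a b = if a ≡ᵇ b then + 1 else + 0

-- Gaussian binomial [a choose b]_q (0 if b > a), via the q-Pascal rule
gauss : ℕ → ℕ → ℕ → ℕ
gauss q a       zero    = 1
gauss q zero    (suc b) = 0
gauss q (suc a) (suc b) = gauss q a b ℕ.+ q ℕ.^ suc b ℕ.* gauss q a (suc b)

sign : ℕ → ℤ
sign zero    = + 1
sign (suc m) = ℤ.- sign m

module Space (𝔽 : FiniteField) (n : ℕ) where
  open FiniteField 𝔽

  E : Set
  E = Vec Carrier n

  _+ᵥ_ : ∀ {m} → Vec Carrier m → Vec Carrier m → Vec Carrier m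
  _+ᵥ_ = Vec.zipWith _+_

  _∙ᵥ_ : ∀ {m} → Carrier → Vec Carrier m → Vec Carrier m
  c ∙ᵥ v = Vec.map (c *_) v

  0ᵥ : ∀ {m} → Vec Carrier m
  0ᵥ = Vec.replicate _ 0#

  _==_ : E → E → Bool
  u == v = does (VecP.≡-dec _≟_ u v)

  vecs : List E
  vecs = power elems n

  Nₑ : ℕ
  Nₑ = length vecs

  -- a subset of E is a list of booleans indexed by the enumeration vecs
  Subset : Set
  Subset = List Bool

  member : E → Subset → Bool
  member v S = foldr _∨_ false (zipWith (λ w b → b ∧ (v == w)) vecs S)

  members : Subset → List E
  members S = filterᵇ (λ v → member v S) vecs

  isSubspaceᵇ : Subset → Bool
  isSubspaceᵇ S =
    (length S ≡ᵇ Nₑ) ∧ member 0ᵥ S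
    ∧ all (λ u → all (λ w → not (member u S ∧ member w S) ∨ member (u +ᵥ w) S) vecs) vecs
    ∧ all (λ c → all (λ u → not (member u S) ∨ member (c ∙ᵥ u) S) vecs) elems

  IsSubspace : Subset → Set
  IsSubspace S = T (isSubspaceᵇ S)

  allSubsets : ℕ → List Subset
  allSubsets zero    = [] ∷ []
  allSubsets (suc m) = concatMap (λ b → map (b ∷_) (allSubsets m)) (true ∷ false ∷ [])

  L : List Subset
  L = filterᵇ isSubspaceᵇ (allSubsets Nₑ)

  m : ℕ
  m = length L

  sub : Fin m → Subset
  sub = lookup L

  _==ˢ_ : Subset → Subset → Bool
  S ==ˢ T′ = does (≡-dec BoolP._≟_ S T′)

  _⊆ᵇ_ : Subset → Subset → Bool
  V ⊆ᵇ W = all (λ v → not (member v V) ∨ member v W) vecs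

  _⊆_ : Subset → Subset → Set
  V ⊆ W = T (V ⊆ᵇ W)

  fullSpace : Subset
  fullSpace = replicate Nₑ true

  _∩_ : Subset → Subset → Subset
  _∩_ = zipWith _∧_

  _⊕_ : Subset → Subset → Subset
  V ⊕ W = map (λ u → any (λ a → member a V ∧ any (λ b → member b W ∧ (u == (a +ᵥ b))) vecs) vecs) vecs

  lincomb : ∀ {d} → Vec Carrier d → Vec E d → E
  lincomb []       []       = 0ᵥ
  lincomb (c ∷ cs) (w ∷ ws) = (c ∙ᵥ w) +ᵥ lincomb cs ws

  independent : ∀ {d} → Vec E d → Bool
  independent {d} ws =
    all (λ c → not (lincomb c ws == 0ᵥ) ∨ does (VecP.≡-dec _≟_ c 0ᵥ)) (power elems d)

  hasIndep : Subset → ℕ → Bool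
  hasIndep S d = any independent (power (members S) d)

  dimFrom : Subset → ℕ → ℕ
  dimFrom S zero    = 0
  dimFrom S (suc d) = if hasIndep S (suc d) then suc d else dimFrom S d

  dim : Subset → ℕ
  dim S = dimFrom S n

  record IsNondegSymBilinear (B : E → E → Carrier) : Set where
    field
      additive : ∀ u v w → B (u +ᵥ v) w ≡ B u w + B v w
      homogeneous : ∀ c u w → B (c ∙ᵥ u) w ≡ c * B u w
      symmetric : ∀ u w → B u w ≡ B w u
      nondegenerate : ∀ v → (∀ w → B v w ≡ 0#) → v ≡ 0ᵥ

  perp : (E → E → Carrier) → Subset → Subset
  perp B V = map (λ w → all (λ v → not (member v V) ∨ does (B v w ≟ 0#)) vecs) vecs

  record IsQMatroid (ρ : Subset → ℕ) : Set where
    field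
      bounded : ∀ V → IsSubspace V → ρ V ≤ dim V
      monotone : ∀ V W → IsSubspace V → IsSubspace W → V ⊆ W → ρ V ≤ ρ W
      submodular : ∀ V W → IsSubspace V → IsSubspace W →
                   ρ (V ⊕ W) ℕ.+ ρ (V ∩ W) ≤ ρ V ℕ.+ ρ W

  module Matrices (B : E → E → Carrier) (ρ : Subset → ℕ) where

    k : ℕ
    k = ρ fullSpace

    -- ν_{i,b} (only used for i ≤ k and b ≤ n - k)
    ν : ℕ → ℕ → ℕ
    ν i b = length (filterᵇ (λ V → (ρ V ≡ᵇ (k ∸ i)) ∧ (dim V ≡ᵇ ((k ∸ i) ℕ.+ b))) L)

    -- N_{i,j} = ν_{i, n-k+i-j}, which is 0 unless 0 ≤ n-k+i-j ≤ n-k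
    Nmat : Mat (suc k) (suc n)
    Nmat i j = if (toℕ j ≤ᵇ (n ∸ k) ℕ.+ toℕ i) ∧ (((n ∸ k) ℕ.+ toℕ i ∸ toℕ j) ≤ᵇ (n ∸ k))
               then + ν (toℕ i) ((n ∸ k) ℕ.+ toℕ i ∸ toℕ j)
               else + 0

    Dmat : Mat (suc n) m
    Dmat i V = δ (toℕ i) (dim (sub V))

    Pmat : Mat m m
    Pmat W V = if sub W ==ˢ perp B (sub V) then + 1 else + 0

    Kmat : Mat m (suc k)
    Kmat V j = δ (k ∸ ρ (sub V)) (toℕ j)

    Fmat : Mat (suc n) (suc n)
    Fmat i j = if toℕ j ≤ᵇ toℕ i
               then sign (toℕ i ∸ toℕ j) ℤ.* (+ (q ℕ.^ ((toℕ i ∸ toℕ j) C 2)))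
                      ℤ.* (+ gauss q (n ∸ toℕ j) (toℕ i ∸ toℕ j))
               else + 0

    μ : Subset → Subset → ℤ
    μ W V = if W ⊆ᵇ V
            then sign (dim V ∸ dim W) ℤ.* (+ (q ℕ.^ ((dim V ∸ dim W) C 2)))
            else + 0

    Mmat : Mat m m
    Mmat V W = μ (sub W) (sub V)

    -- part (a), evaluated in a commutative ring R at x, y with y invertible
    module Eval (R : CommutativeRing 0ℓ 0ℓ) where
      open CommutativeRing R renaming (Carrier to A; _+_ to _⊞_; _*_ to _⊠_; -_ to ⊟_; 0# to 𝟘; 1# to 𝟙)

      _^ᴿ_ : A → ℕ → A
      a ^ᴿ zero  = 𝟙
      a ^ᴿ suc e = a ⊠ (a ^ᴿ e)

      fromℤ : ℤ → A
      fromℤ (+ zero)         = 𝟘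
      fromℤ (+ suc a)        = 𝟙 ⊞ fromℤ (+ a)
      fromℤ ℤ.-[1+ zero ]    = ⊟ 𝟙
      fromℤ ℤ.-[1+ suc a ]   = (⊟ 𝟙) ⊞ fromℤ ℤ.-[1+ a ]

      ∑ᴿ : (l : ℕ) → (Fin l → A) → A
      ∑ᴿ l f = foldr _⊞_ 𝟘 (map f (allFin l))

      -- u N^T v^T with u_j = y^{n-j}, v_i = x^i y^{i-k} = x^i (y⁻¹)^{k-i}
      uNv : (x y y⁻¹ : A) → A
      uNv x y y⁻¹ = ∑ᴿ (suc n) (λ j → ∑ᴿ (suc k) (λ i →
                      (y ^ᴿ (n ∸ toℕ j)) ⊠ (fromℤ ((Nmat ᵀ) j i) ⊠ ((x ^ᴿ toℕ i) ⊠ (y⁻¹ ^ᴿ (k ∸ toℕ i))))))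

      whitney : (x y : A) → A
      whitney x y = ∑ᴿ m (λ V → (x ^ᴿ (k ∸ ρ (sub V))) ⊠ (y ^ᴿ (dim (sub V) ∸ ρ (sub V))))

{-# OPTIONS --safe #-}
module Submission where

open import Defs
open import Level using (0ℓ)
open import Data.Nat using (ℕ)
open import Data.Product using (_×_)
open import Relation.Binary.PropositionalEquality using (_≡_)
open import Algebra.Bundles using (CommutativeRing)
open import Data.Product using (Σ; ∃; _,_)
open import Algebra.Bundles using (CommutativeSemiring)
open import Relation.Binary.Definitions using (DecidableEquality)

-- Each subspace V adds a single unit to the entry (N^T)_{n - dim V, k - ρ V}, whose weight u_j v_i
-- is exactly the monomial x^(k - ρ V) y^(dim V - ρ V) of R_M; the inequalities ρ V ≤ dim V and
-- dim V + k ≤ n + ρ V (submodularity against a complement of V) keep this entry inside the range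
-- where N is given by ν, which gives (a).  Part (b) holds because V^⊥ occurs exactly once in L(E)
-- and dim V^⊥ = n - dim V for a nondegenerate form.  For (c), (DM)_{i,W} is the common value of
-- μ(W,V) over dim V = i times the number of i-dimensional subspaces V ⊇ W; double counting the
-- independent extensions of a basis of W shows that this number is [n - dim W choose i - dim W]_q.

module Sums {c ℓ} (S : CommutativeSemiring c ℓ) where

  open import Data.Bool using (Bool; true; false; _∧_; if_then_else_)
  open import Data.Nat using (zero; suc; _≡ᵇ_; _<_; s≤s)
  open import Data.Fin using (Fin; toℕ) renaming (zero to fzero; suc to fsuc)
  open import Data.List using (List; []; _∷_; map; foldr; length; filterᵇ; concatMap; allFin; lookup; _++_)
  import Data.List.Properties as Listₚ
  open import Function using (_∘_; id)
  import Relation.Binary.PropositionalEquality as ≡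
  open CommutativeSemiring S
  open import Relation.Binary.Reasoning.Setoid setoid
  open import Algebra.Properties.CommutativeSemigroup +-commutativeSemigroup using (x∙yz≈y∙xz)

  sumMap : {X : Set} → (X → Carrier) → List X → Carrier
  sumMap f xs = foldr _+_ 0# (map f xs)

  iverson : Bool → Carrier
  iverson b = if b then 1# else 0#

  count : {X : Set} → (X → Bool) → List X → Carrier
  count p = sumMap (iverson ∘ p)

  iverson-∧ : ∀ a b → iverson (a ∧ b) ≈ iverson a * iverson b
  iverson-∧ true  b = sym (*-identityˡ (iverson b))
  iverson-∧ false b = sym (zeroˡ (iverson b))

  iverson-* : ∀ b x → iverson b * x ≈ (if b then x else 0#)
  iverson-* true  x = *-identityˡ x
  iverson-* false x = zeroˡ x

  module _ {X : Set} where

    sumMap-cong : {f g : X → Carrier} (xs : List X) → (∀ x → f x ≈ g x) → sumMap f xs ≈ sumMap g xs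
    sumMap-cong []       f≈g = refl
    sumMap-cong (x ∷ xs) f≈g = +-cong (f≈g x) (sumMap-cong xs f≈g)

    sumMap-cong-filterᵇ : (p : X → Bool) {f g : X → Carrier} (xs : List X) →
                          (∀ x → p x ≡ true → f x ≈ g x) →
                          sumMap f (filterᵇ p xs) ≈ sumMap g (filterᵇ p xs)
    sumMap-cong-filterᵇ p []       f≈g = refl
    sumMap-cong-filterᵇ p (x ∷ xs) f≈g with p x in px
    ... | true  = +-cong (f≈g x px) (sumMap-cong-filterᵇ p xs f≈g)
    ... | false = sumMap-cong-filterᵇ p xs f≈g

    sumMap-0 : {f : X → Carrier} (xs : List X) → (∀ x → f x ≈ 0#) → sumMap f xs ≈ 0#
    sumMap-0 []       f≈0 = refl
    sumMap-0 (x ∷ xs) f≈0 = trans (+-cong (f≈0 x) (sumMap-0 xs f≈0)) (+-identityˡ 0#)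

    sumMap-distrib-+ : (f g : X → Carrier) (xs : List X) →
                       sumMap (λ x → f x + g x) xs ≈ sumMap f xs + sumMap g xs
    sumMap-distrib-+ f g []       = sym (+-identityˡ 0#)
    sumMap-distrib-+ f g (x ∷ xs) = begin
      (f x + g x) + sumMap (λ x → f x + g x) xs    ≈⟨ +-congˡ (sumMap-distrib-+ f g xs) ⟩
      (f x + g x) + (sumMap f xs + sumMap g xs)    ≈⟨ +-assoc (f x) (g x) _ ⟩
      f x + (g x + (sumMap f xs + sumMap g xs))    ≈⟨ +-congˡ (x∙yz≈y∙xz (g x) (sumMap f xs) _) ⟩
      f x + (sumMap f xs + (g x + sumMap g xs))    ≈⟨ sym (+-assoc (f x) (sumMap f xs) _) ⟩
      (f x + sumMap f xs) + (g x + sumMap g xs)    ∎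

    *-distribˡ-sumMap : (a : Carrier) (f : X → Carrier) (xs : List X) →
                        a * sumMap f xs ≈ sumMap (λ x → a * f x) xs
    *-distribˡ-sumMap a f []       = zeroʳ a
    *-distribˡ-sumMap a f (x ∷ xs) = trans (distribˡ a (f x) _) (+-congˡ (*-distribˡ-sumMap a f xs))

    *-distribʳ-sumMap : (a : Carrier) (f : X → Carrier) (xs : List X) →
                        sumMap f xs * a ≈ sumMap (λ x → f x * a) xs
    *-distribʳ-sumMap a f xs =
      trans (*-comm _ a) (trans (*-distribˡ-sumMap a f xs) (sumMap-cong xs (λ x → *-comm a (f x))))

    sumMap-++ : (f : X → Carrier) (xs ys : List X) → sumMap f (xs ++ ys) ≈ sumMap f xs + sumMap f ys
    sumMap-++ f []       ys = sym (+-identityˡ _)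
    sumMap-++ f (x ∷ xs) ys = trans (+-congˡ (sumMap-++ f xs ys)) (sym (+-assoc (f x) _ _))

  module _ {X Y : Set} where

    sumMap-map : (f : Y → Carrier) (g : X → Y) (xs : List X) → sumMap f (map g xs) ≡ sumMap (f ∘ g) xs
    sumMap-map f g xs = ≡.cong (foldr _+_ 0#) (≡.sym (Listₚ.map-∘ xs))

    sumMap-concatMap : (f : Y → Carrier) (g : X → List Y) (xs : List X) →
                       sumMap f (concatMap g xs) ≈ sumMap (λ x → sumMap f (g x)) xs
    sumMap-concatMap f g []       = refl
    sumMap-concatMap f g (x ∷ xs) = trans (sumMap-++ f (g x) _) (+-congˡ (sumMap-concatMap f g xs))

    sumMap-swap : (f : X → Y → Carrier) (xs : List X) (ys : List Y) →
                  sumMap (λ x → sumMap (f x) ys) xs ≈ sumMap (λ y → sumMap (λ x → f x y) xs) ys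
    sumMap-swap f []       ys = sym (sumMap-0 ys (λ _ → refl))
    sumMap-swap f (x ∷ xs) ys =
      trans (+-congˡ (sumMap-swap f xs ys)) (sym (sumMap-distrib-+ (f x) (λ y → sumMap (λ x → f x y) xs) ys))

  sumMap-allFin-lookup : {X : Set} (h : X → Carrier) (xs : List X) →
                         sumMap (h ∘ lookup xs) (allFin (length xs)) ≡ sumMap h xs
  sumMap-allFin-lookup h xs = ≡.cong (foldr _+_ 0#) (≡.trans (Listₚ.map-tabulate id (h ∘ lookup xs))
    (≡.trans (≡.sym (Listₚ.map-tabulate (lookup xs) h)) (≡.cong (map h) (Listₚ.tabulate-lookup xs))))

  sumMap-allFin-suc : ∀ m (f : Fin (suc m) → Carrier) →
                      sumMap f (allFin (suc m)) ≡ f fzero + sumMap (f ∘ fsuc) (allFin m)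
  sumMap-allFin-suc m f = ≡.cong (λ xs → f fzero + foldr _+_ 0# xs)
    (≡.trans (Listₚ.map-tabulate fsuc f) (≡.sym (Listₚ.map-tabulate id (f ∘ fsuc))))

  sumMap-allFin-single : ∀ m (h : ℕ → Carrier) a → a < m →
                         sumMap (λ j → if a ≡ᵇ toℕ j then h (toℕ j) else 0#) (allFin m) ≈ h a
  sumMap-allFin-single (suc m) h zero _ = begin
      sumMap (λ j → if 0 ≡ᵇ toℕ j then h (toℕ j) else 0#) (allFin (suc m))
    ≡⟨ sumMap-allFin-suc m _ ⟩
      h 0 + sumMap (λ _ → 0#) (allFin m)
    ≈⟨ +-congˡ (sumMap-0 (allFin m) (λ _ → refl)) ⟩
      h 0 + 0#
    ≈⟨ +-identityʳ (h 0) ⟩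
      h 0 ∎
  sumMap-allFin-single (suc m) h (suc a) (s≤s a<m) = begin
      sumMap (λ j → if suc a ≡ᵇ toℕ j then h (toℕ j) else 0#) (allFin (suc m))
    ≡⟨ sumMap-allFin-suc m _ ⟩
      0# + sumMap (λ j → if a ≡ᵇ toℕ j then h (suc (toℕ j)) else 0#) (allFin m)
    ≈⟨ +-identityˡ _ ⟩
      sumMap (λ j → if a ≡ᵇ toℕ j then h (suc (toℕ j)) else 0#) (allFin m)
    ≈⟨ sumMap-allFin-single m (h ∘ suc) a a<m ⟩
      h (suc a) ∎

  module _ (fromℕ : ℕ → Carrier) (fromℕ-zero : fromℕ 0 ≈ 0#) (fromℕ-suc : ∀ m → fromℕ (suc m) ≈ 1# + fromℕ m) where

    fromℕ-length-filterᵇ : {X : Set} (p : X → Bool) (xs : List X) → fromℕ (length (filterᵇ p xs)) ≈ count p xs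
    fromℕ-length-filterᵇ p []       = fromℕ-zero
    fromℕ-length-filterᵇ p (x ∷ xs) with p x
    ... | true  = trans (fromℕ-suc _) (+-congˡ (fromℕ-length-filterᵇ p xs))
    ... | false = trans (fromℕ-length-filterᵇ p xs) (sym (+-identityˡ _))

module Booleans where

  open import Data.Bool using (Bool; true; false; _∧_; _∨_; not)
  open import Data.Bool.ListAction using (all)
  open import Data.List using (List; []; _∷_)
  open import Data.Nat using (_≡ᵇ_; _≤ᵇ_; _≤_)
  import Data.Nat.Properties as ℕₚ
  open import Data.Bool.Properties using (T-≡)
  open import Function using (Equivalence)
  open import Relation.Binary.PropositionalEquality using (refl; sym)

  ∧-trueˡ : ∀ {a b} → a ∧ b ≡ true → a ≡ true
  ∧-trueˡ {true} _ = refl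

  ∧-trueʳ : ∀ {a b} → a ∧ b ≡ true → b ≡ true
  ∧-trueʳ {true} b≡true = b≡true

  ∧-true⁻ : ∀ {a b} → a ∧ b ≡ true → a ≡ true × b ≡ true
  ∧-true⁻ {true} b≡true = refl , b≡true

  ∧-true : ∀ {a b} → a ≡ true → b ≡ true → a ∧ b ≡ true
  ∧-true refl refl = refl

  ⇒ᵇ-intro : ∀ {a b} → (a ≡ true → b ≡ true) → not a ∨ b ≡ true
  ⇒ᵇ-intro {false} _ = refl
  ⇒ᵇ-intro {true}  f = f refl

  ⇒ᵇ-elim : ∀ {a b} → not a ∨ b ≡ true → a ≡ true → b ≡ true
  ⇒ᵇ-elim {true} b≡true refl = b≡true

  ⇒ᵇ-false : ∀ {a b} → not a ∨ b ≡ false → a ≡ true × b ≡ false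
  ⇒ᵇ-false {true} {false} _ = refl , refl

  true-ext : ∀ {a b} → (a ≡ true → b ≡ true) → (b ≡ true → a ≡ true) → a ≡ b
  true-ext {false} {false} _ _ = refl
  true-ext {false} {true}  _ g = g refl
  true-ext {true}          f _ = sym (f refl)

  ≡ᵇ-sound : ∀ {m n} → (m ≡ᵇ n) ≡ true → m ≡ n
  ≡ᵇ-sound {m} {n} e = ℕₚ.≡ᵇ⇒≡ m n (Equivalence.from T-≡ e)

  ≡ᵇ-complete : ∀ {m n} → m ≡ n → (m ≡ᵇ n) ≡ true
  ≡ᵇ-complete {m} {n} e = Equivalence.to T-≡ (ℕₚ.≡⇒≡ᵇ m n e)

  ≤ᵇ-sound : ∀ {m n} → (m ≤ᵇ n) ≡ true → m ≤ n
  ≤ᵇ-sound {m} {n} e = ℕₚ.≤ᵇ⇒≤ m n (Equivalence.from T-≡ e)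

  ≤ᵇ-complete : ∀ {m n} → m ≤ n → (m ≤ᵇ n) ≡ true
  ≤ᵇ-complete m≤n = Equivalence.to T-≡ (ℕₚ.≤⇒≤ᵇ m≤n)

  ≡ᵇ-sym : ∀ m n → (m ≡ᵇ n) ≡ (n ≡ᵇ m)
  ≡ᵇ-sym m n = true-ext (λ e → ≡ᵇ-complete (sym (≡ᵇ-sound {m} e))) (λ e → ≡ᵇ-complete (sym (≡ᵇ-sound {n} e)))

  all-true⁺ : {X : Set} (p : X → Bool) (xs : List X) → (∀ x → p x ≡ true) → all p xs ≡ true
  all-true⁺ p []       _     = refl
  all-true⁺ p (x ∷ xs) all-p rewrite all-p x = all-true⁺ p xs all-p

  all-false⁻ : {X : Set} (p : X → Bool) (xs : List X) → all p xs ≡ false → ∃ λ x → p x ≡ false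
  all-false⁻ p (x ∷ xs) all-p with p x in px
  ... | false = x , px
  ... | true  = all-false⁻ p xs all-p

module ℕSums where

  open import Data.Bool using (Bool; true; false)
  open import Data.Nat using (suc; _+_; _*_; _≤_; z≤n; s≤s)
  import Data.Nat.Properties as ℕₚ
  open import Data.List using (List; []; _∷_; length; filterᵇ)
  open import Relation.Binary.PropositionalEquality using (refl; cong)
  open Sums ℕₚ.+-*-commutativeSemiring public

  sumMap-mono-≤ : {X : Set} {f g : X → ℕ} (xs : List X) → (∀ x → f x ≤ g x) → sumMap f xs ≤ sumMap g xs
  sumMap-mono-≤ []       f≤g = z≤n
  sumMap-mono-≤ (x ∷ xs) f≤g = ℕₚ.+-mono-≤ (f≤g x) (sumMap-mono-≤ xs f≤g)

  sumMap-const : {X : Set} (c : ℕ) (xs : List X) → sumMap (λ _ → c) xs ≡ length xs * c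
  sumMap-const c []       = refl
  sumMap-const c (x ∷ xs) = cong (c +_) (sumMap-const c xs)

  count-true : {X : Set} (xs : List X) → count (λ _ → true) xs ≡ length xs
  count-true []       = refl
  count-true (x ∷ xs) = cong suc (count-true xs)

  count≤length : {X : Set} (p : X → Bool) (xs : List X) → count p xs ≤ length xs
  count≤length p []       = z≤n
  count≤length p (x ∷ xs) with p x
  ... | true  = s≤s (count≤length p xs)
  ... | false = ℕₚ.m≤n⇒m≤1+n (count≤length p xs)

  length-filterᵇ : {X : Set} (p : X → Bool) (xs : List X) → length (filterᵇ p xs) ≡ count p xs
  length-filterᵇ = fromℕ-length-filterᵇ (λ m → m) refl (λ _ → refl)

module Counting where

  open import Data.Bool using (Bool; true; false; _∧_; not)
  open import Data.Nat using (suc; _+_; _*_; _≤_; z≤n; s≤s)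
  import Data.Nat.Properties as ℕₚ
  open import Data.List using (List; []; _∷_; filterᵇ)
  open import Relation.Binary.PropositionalEquality using (refl; sym; trans; cong)
  open ℕSums

  iverson-mono : ∀ {a b} → (a ≡ true → b ≡ true) → iverson a ≤ iverson b
  iverson-mono {false}         _ = z≤n
  iverson-mono {true}  {true}  _ = s≤s z≤n
  iverson-mono {true}  {false} f with () ← f refl

  iverson-*-cong : ∀ b {x y} → (b ≡ true → x ≡ y) → iverson b * x ≡ iverson b * y
  iverson-*-cong true  x≡y = cong (_+ 0) (x≡y refl)
  iverson-*-cong false _   = refl

  count-mono : {X : Set} (p q : X → Bool) (xs : List X) → (∀ x → p x ≡ true → q x ≡ true) →
               count p xs ≤ count q xs
  count-mono p q xs p⇒q = sumMap-mono-≤ xs (λ x → iverson-mono (p⇒q x))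

  count-filterᵇ : {X : Set} (p q : X → Bool) (xs : List X) → count q (filterᵇ p xs) ≡ count (λ x → p x ∧ q x) xs
  count-filterᵇ p q []       = refl
  count-filterᵇ p q (x ∷ xs) with p x
  ... | true  = cong (iverson (q x) +_) (count-filterᵇ p q xs)
  ... | false = count-filterᵇ p q xs

  count-split : {X : Set} (p p′ : X → Bool) (xs : List X) → (∀ x → p′ x ≡ true → p x ≡ true) →
                count p xs ≡ count p′ xs + count (λ x → p x ∧ not (p′ x)) xs
  count-split p p′ []       p′⇒p = refl
  count-split p p′ (x ∷ xs) p′⇒p with p x in px | p′ x in p′x
  ... | true  | true  = cong suc (count-split p p′ xs p′⇒p)
  ... | true  | false = trans (cong suc (count-split p p′ xs p′⇒p)) (sym (ℕₚ.+-suc _ _))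
  ... | false | false = count-split p p′ xs p′⇒p
  ... | false | true  with () ← trans (sym px) (p′⇒p x p′x)

  count-0 : {X : Set} (p : X → Bool) (xs : List X) → (∀ x → p x ≡ false) → count p xs ≡ 0
  count-0 p xs p≡false = sumMap-0 xs (λ x → cong iverson (p≡false x))

module Multiplicity {A : Set} (_≟_ : DecidableEquality A) where

  open import Data.Bool using (Bool; true; false; _∧_; _∨_)
  open import Data.Bool.ListAction using (all; any)
  open import Data.Nat using (suc; _+_; _*_; _≤_; z≤n; s≤s)
  import Data.Nat.Properties as ℕₚ
  open import Data.List using (List; []; _∷_; map; foldr; zipWith; replicate; length; filterᵇ)
  open import Data.List.Membership.Propositional using (_∈_)
  open import Data.List.Relation.Unary.Any using (here; there)
  open import Data.List.Relation.Unary.All using (All; []; _∷_)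
  open import Data.List.Relation.Unary.AllPairs using ([]; _∷_)
  open import Data.List.Relation.Unary.Unique.Propositional using (Unique)
  import Data.Bool.Properties as Boolₚ
  open import Data.Empty using (⊥)
  open import Relation.Nullary using (does; yes; no)
  open import Relation.Nullary.Decidable using (dec-true; dec-false)
  open import Relation.Binary.PropositionalEquality
  open ℕSums
  open Booleans
  open Counting

  infix 4 _=ᵇ_
  _=ᵇ_ : A → A → Bool
  a =ᵇ b = does (a ≟ b)

  =ᵇ-refl : ∀ a → (a =ᵇ a) ≡ true
  =ᵇ-refl a = dec-true (a ≟ a) refl

  =ᵇ-sound : ∀ {a b} → (a =ᵇ b) ≡ true → a ≡ b
  =ᵇ-sound {a} {b} a=b with a ≟ b
  ... | yes a≡b = a≡b

  =ᵇ-sym : ∀ a b → (a =ᵇ b) ≡ (b =ᵇ a)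
  =ᵇ-sym a b = true-ext (λ e → subst (λ z → (z =ᵇ a) ≡ true) (=ᵇ-sound e) (=ᵇ-refl a))
                        (λ e → subst (λ z → (z =ᵇ b) ≡ true) (=ᵇ-sound e) (=ᵇ-refl b))

  mult : A → List A → ℕ
  mult a = count (a =ᵇ_)

  IsEnumeration : List A → Set
  IsEnumeration xs = ∀ a → mult a xs ≡ 1

  NoDuplicates : List A → Set
  NoDuplicates xs = ∀ a → mult a xs ≤ 1

  NoDuplicates-tail : ∀ {x xs} → NoDuplicates (x ∷ xs) → NoDuplicates xs
  NoDuplicates-tail {x} {xs} nd a = ℕₚ.≤-trans (ℕₚ.m≤n+m (mult a xs) (iverson (a =ᵇ x))) (nd a)

  mult-head : ∀ x xs → mult x (x ∷ xs) ≡ suc (mult x xs)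
  mult-head x xs = cong (λ b → iverson b + mult x xs) (=ᵇ-refl x)

  count-single : (p : A → Bool) (a : A) (xs : List A) → (∀ x → p x ≡ (a =ᵇ x)) → count p xs ≡ mult a xs
  count-single p a xs p≡a= = sumMap-cong xs (λ x → cong iverson (p≡a= x))

  count≤1 : (p : A → Bool) (xs : List A) → NoDuplicates xs →
            (∀ x y → p x ≡ true → p y ≡ true → x ≡ y) → count p xs ≤ 1
  count≤1 p []       nd p-unique = z≤n
  count≤1 p (x ∷ xs) nd p-unique with p x in px
  ... | false = count≤1 p xs (NoDuplicates-tail {x} {xs} nd) p-unique
  ... | true  = s≤s (ℕₚ.≤-trans (count-mono p (x =ᵇ_) xs p⇒x=)
                                  (ℕₚ.≤-pred (subst (_≤ 1) (mult-head x xs) (nd x))))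
    where
    p⇒x= : ∀ y → p y ≡ true → (x =ᵇ y) ≡ true
    p⇒x= y py = subst (λ z → (x =ᵇ z) ≡ true) (p-unique x y px py) (=ᵇ-refl x)

  mult-absent : (a : A) (xs : List A) → All (a ≢_) xs → mult a xs ≡ 0
  mult-absent a []       []          = refl
  mult-absent a (x ∷ xs) (a≢x ∷ a∉) =
    trans (cong (λ b → iverson b + mult a xs) (dec-false (a ≟ x) a≢x)) (mult-absent a xs a∉)

  Unique⇒mult≡1 : (a : A) (xs : List A) → a ∈ xs → Unique xs → mult a xs ≡ 1
  Unique⇒mult≡1 a (x ∷ xs) (here refl) (a∉ ∷ _) = trans (mult-head a xs) (cong suc (mult-absent a xs a∉))
  Unique⇒mult≡1 a (x ∷ xs) (there a∈) (x∉ ∷ u) =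
    trans (cong (λ b → iverson b + mult a xs) (dec-false (a ≟ x) (λ a≡x → ∉ x∉ (subst (_∈ xs) a≡x a∈))))
          (Unique⇒mult≡1 a xs a∈ u)
    where
    ∉ : ∀ {y ys} → All (y ≢_) ys → y ∈ ys → ⊥
    ∉ (y≢z ∷ _)  (here y≡z) = y≢z y≡z
    ∉ (_ ∷ y∉)   (there y∈) = ∉ y∉ y∈

  mult-filterᵇ : (p : A → Bool) (xs : List A) (x : A) → mult x (filterᵇ p xs) ≡ iverson (p x) * mult x xs
  mult-filterᵇ p xs x = begin
    count (x =ᵇ_) (filterᵇ p xs)                   ≡⟨ count-filterᵇ p (x =ᵇ_) xs ⟩
    count (λ y → p y ∧ (x =ᵇ y)) xs                ≡⟨ sumMap-cong xs (λ y → cong iverson (p∧x= y)) ⟩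
    sumMap (λ y → iverson (p x ∧ (x =ᵇ y))) xs     ≡⟨ sumMap-cong xs (λ y → iverson-∧ (p x) (x =ᵇ y)) ⟩
    sumMap (λ y → iverson (p x) * iverson (x =ᵇ y)) xs ≡⟨ *-distribˡ-sumMap (iverson (p x)) _ xs ⟨
    iverson (p x) * mult x xs                       ∎
    where
    open ≡-Reasoning
    p∧x= : ∀ y → (p y ∧ (x =ᵇ y)) ≡ (p x ∧ (x =ᵇ y))
    p∧x= y with x ≟ y
    ... | yes refl = refl
    ... | no _     = trans (Boolₚ.∧-zeroʳ (p y)) (sym (Boolₚ.∧-zeroʳ (p x)))

  all-true : (p : A → Bool) (xs : List A) (x : A) → 1 ≤ mult x xs → all p xs ≡ true → p x ≡ true
  all-true p (y ∷ xs) x x∈ all-p with x ≟ y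
  ... | yes refl = ∧-trueˡ all-p
  ... | no _     = all-true p xs x x∈ (∧-trueʳ {p y} all-p)

  any-true : (p : A → Bool) (xs : List A) (x : A) → 1 ≤ mult x xs → p x ≡ true → any p xs ≡ true
  any-true p (y ∷ xs) x x∈ px with x ≟ y
  ... | yes refl rewrite px = refl
  ... | no _     rewrite any-true p xs x x∈ px = Boolₚ.∨-zeroʳ (p y)

  any-true⁻ : (p : A → Bool) (xs : List A) → any p xs ≡ true → ∃ λ x → 1 ≤ mult x xs × p x ≡ true
  any-true⁻ p (x ∷ xs) any-p with p x in px
  ... | true  = x , subst (1 ≤_) (sym (mult-head x xs)) (s≤s z≤n) , px
  ... | false with any-true⁻ p xs any-p
  ...   | y , y∈ , py = y , ℕₚ.≤-trans y∈ (ℕₚ.m≤n+m (mult y xs) _) , py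

  all-true-enum : (p : A → Bool) (xs : List A) → IsEnumeration xs → all p xs ≡ true → ∀ x → p x ≡ true
  all-true-enum p xs enum all-p x = all-true p xs x (ℕₚ.≤-reflexive (sym (enum x))) all-p

  any-true-enum : (p : A → Bool) (xs : List A) → IsEnumeration xs → ∀ x → p x ≡ true → any p xs ≡ true
  any-true-enum p xs enum x = any-true p xs x (ℕₚ.≤-reflexive (sym (enum x)))

  -- Space.member is memberOf vecs: a subset is a boolean list indexed by a reference list.
  memberOf : List A → A → List Bool → Bool
  memberOf ws v S = foldr _∨_ false (zipWith (λ w b → b ∧ (v =ᵇ w)) ws S)

  memberOf-absent : (ws : List A) (v : A) (S : List Bool) → mult v ws ≡ 0 → memberOf ws v S ≡ false
  memberOf-absent []       v S       _ = refl
  memberOf-absent (w ∷ ws) v []      _ = refl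
  memberOf-absent (w ∷ ws) v (b ∷ S) v∉ with v ≟ w
  ... | no _ rewrite Boolₚ.∧-zeroʳ b = memberOf-absent ws v S v∉

  memberOf-map : (ws : List A) (v : A) (P : A → Bool) → mult v ws ≡ 1 → memberOf ws v (map P ws) ≡ P v
  memberOf-map (w ∷ ws) v P v∈! with v ≟ w
  ... | yes refl rewrite memberOf-absent ws v (map P ws) (ℕₚ.suc-injective v∈!)
                       | Boolₚ.∧-identityʳ (P v) = Boolₚ.∨-identityʳ (P v)
  ... | no _     rewrite Boolₚ.∧-zeroʳ (P w) = memberOf-map ws v P v∈!

  memberOf-replicate : (ws : List A) (v : A) → mult v ws ≡ 1 → memberOf ws v (replicate (length ws) true) ≡ true
  memberOf-replicate (w ∷ ws) v v∈! with v ≟ w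
  ... | yes refl = refl
  ... | no _     = memberOf-replicate ws v v∈!

  memberOf-ext : (ws : List A) (S S′ : List Bool) → length S ≡ length ws → length S′ ≡ length ws →
                 NoDuplicates ws → (∀ v → memberOf ws v S ≡ memberOf ws v S′) → S ≡ S′
  memberOf-ext []       []      []        _  _   _  _     = refl
  memberOf-ext (w ∷ ws) (b ∷ S) (b′ ∷ S′) ∣S∣ ∣S′∣ nd S≗S′ =
    cong₂ _∷_ b≡b′ (memberOf-ext ws S S′ (ℕₚ.suc-injective ∣S∣) (ℕₚ.suc-injective ∣S′∣)
                                 (NoDuplicates-tail {w} {ws} nd) tail≗)
    where
    w∉ws : mult w ws ≡ 0
    w∉ws = ℕₚ.≤-antisym (ℕₚ.≤-pred (subst (_≤ 1) (mult-head w ws) (nd w))) z≤n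
    b≡b′ : b ≡ b′
    b≡b′ with S≗S′ w
    ... | e rewrite =ᵇ-refl w | memberOf-absent ws w S w∉ws | memberOf-absent ws w S′ w∉ws
                  | Boolₚ.∧-identityʳ b | Boolₚ.∧-identityʳ b′
                  | Boolₚ.∨-identityʳ b | Boolₚ.∨-identityʳ b′ = e
    tail≗ : ∀ v → memberOf ws v S ≡ memberOf ws v S′
    tail≗ v with v ≟ w | S≗S′ v
    ... | yes refl | _ rewrite memberOf-absent ws v S w∉ws | memberOf-absent ws v S′ w∉ws = refl
    ... | no _     | e rewrite Boolₚ.∧-zeroʳ b | Boolₚ.∧-zeroʳ b′ = e

module Image {A B : Set} (_≟ᴬ_ : DecidableEquality A) (_≟ᴮ_ : DecidableEquality B) where

  open import Data.Bool using (Bool; true; false; _∧_)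
  open import Data.Nat using (_*_; _≤_)
  import Data.Nat.Properties as ℕₚ
  open import Data.List using (List; length)
  open import Relation.Nullary using (yes; no)
  open import Relation.Binary.PropositionalEquality
  open ℕSums
  open Counting
  open Booleans
  module MA = Multiplicity _≟ᴬ_
  module MB = Multiplicity _≟ᴮ_

  count-image : (f : A → B) (xs : List A) (ys : List B) → MA.IsEnumeration xs → MB.IsEnumeration ys →
                (∀ a a′ → f a ≡ f a′ → a ≡ a′) → (P : B → Bool) →
                (∀ b → P b ≡ true → ∃ λ a → f a ≡ b) → (∀ a → P (f a) ≡ true) → count P ys ≡ length xs
  count-image f xs ys xs-enum ys-enum f-inj P P⇒image image⇒P = begin
      count P ys                                                ≡⟨ sumMap-cong ys fibre ⟩
      sumMap (λ y → sumMap (λ x → iverson (f x MB.=ᵇ y)) xs) ys ≡⟨ sumMap-swap _ xs ys ⟨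
      sumMap (λ x → MB.mult (f x) ys) xs                        ≡⟨ sumMap-cong xs (λ x → ys-enum (f x)) ⟩
      count (λ _ → true) xs                                     ≡⟨ count-true xs ⟩
      length xs                                                 ∎
    where
    open ≡-Reasoning
    fibre : ∀ y → iverson (P y) ≡ sumMap (λ x → iverson (f x MB.=ᵇ y)) xs
    fibre y with P y in Py
    ... | true with P⇒image y Py
    ...   | a , refl = sym (trans (MA.count-single _ a xs fa=⇔a=) (xs-enum a))
      where
      fa=⇔a= : ∀ x → (f x MB.=ᵇ f a) ≡ (a MA.=ᵇ x)
      fa=⇔a= x = true-ext (λ e → subst (λ z → (a MA.=ᵇ z) ≡ true) (f-inj a x (sym (MB.=ᵇ-sound e))) (MA.=ᵇ-refl a))
                          (λ e → subst (λ z → (f z MB.=ᵇ f a) ≡ true) (MA.=ᵇ-sound e) (MB.=ᵇ-refl (f a)))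
    fibre y | false = sym (count-0 _ xs fx≠y)
      where
      fx≠y : ∀ x → (f x MB.=ᵇ y) ≡ false
      fx≠y x with f x ≟ᴮ y
      ... | yes refl with () ← trans (sym (image⇒P x)) Py
      ... | no _     = refl

  count-injective-≤ : (f : A → B) (xs : List A) (ys : List B) → MA.NoDuplicates xs → MB.IsEnumeration ys →
                      (P : A → Bool) → (∀ a a′ → P a ≡ true → P a′ ≡ true → f a ≡ f a′ → a ≡ a′) →
                      count P xs ≤ length ys
  count-injective-≤ f xs ys xs-nd ys-enum P f-inj = begin
      count P xs
    ≡⟨ sumMap-cong xs (λ x → sym (trans (cong (iverson (P x) *_) (ys-enum (f x))) (ℕₚ.*-identityʳ _))) ⟩
      sumMap (λ x → iverson (P x) * MB.mult (f x) ys) xs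
    ≡⟨ sumMap-cong xs (λ x → *-distribˡ-sumMap (iverson (P x)) _ ys) ⟩
      sumMap (λ x → sumMap (λ y → iverson (P x) * iverson (f x MB.=ᵇ y)) ys) xs
    ≡⟨ sumMap-swap _ xs ys ⟩
      sumMap (λ y → sumMap (λ x → iverson (P x) * iverson (f x MB.=ᵇ y)) xs) ys
    ≤⟨ sumMap-mono-≤ ys fibre≤1 ⟩
      count (λ _ → true) ys
    ≡⟨ count-true ys ⟩
      length ys ∎
    where
    open ℕₚ.≤-Reasoning
    fibre≤1 : ∀ y → sumMap (λ x → iverson (P x) * iverson (f x MB.=ᵇ y)) xs ≤ 1
    fibre≤1 y = ℕₚ.≤-trans (ℕₚ.≤-reflexive (sumMap-cong xs (λ x → sym (iverson-∧ (P x) (f x MB.=ᵇ y)))))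
                           (MA.count≤1 _ xs xs-nd unique)
      where
      unique : ∀ a a′ → (P a ∧ (f a MB.=ᵇ y)) ≡ true → (P a′ ∧ (f a′ MB.=ᵇ y)) ≡ true → a ≡ a′
      unique a a′ h h′ = f-inj a a′ (∧-trueˡ h) (∧-trueˡ h′)
                           (trans (MB.=ᵇ-sound (∧-trueʳ {P a} h)) (sym (MB.=ᵇ-sound (∧-trueʳ {P a′} h′))))

module Powers {A : Set} (_≟_ : DecidableEquality A) where

  open import Data.Bool using (true; _∧_)
  open import Data.Nat using (zero; suc; _*_; _^_; _≤_; z≤n; s≤s)
  import Data.Nat.Properties as ℕₚ
  open import Data.List using (List; []; _∷_; map; length; concatMap)
  import Data.List.Properties as Listₚ
  open import Data.Vec using (Vec; []; _∷_)
  import Data.Vec.Properties as Vecₚ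
  open import Data.Vec.Relation.Unary.All using (All; []; _∷_)
  open import Relation.Binary.PropositionalEquality
  open ℕSums
  open Multiplicity _≟_ using (mult; IsEnumeration; _=ᵇ_)
  module MV {d : ℕ} = Multiplicity (Vecₚ.≡-dec {n = d} _≟_)

  mult-power : (xs : List A) (d : ℕ) (a : A) (w : Vec A d) →
               MV.mult (a ∷ w) (power xs (suc d)) ≡ mult a xs * MV.mult w (power xs d)
  mult-power xs d a w = begin
      MV.mult (a ∷ w) (concatMap (λ x → map (x ∷_) (power xs d)) xs)
    ≡⟨ sumMap-concatMap _ _ xs ⟩
      sumMap (λ x → MV.mult (a ∷ w) (map (x ∷_) (power xs d))) xs
    ≡⟨ sumMap-cong xs (λ x → sumMap-map _ (x ∷_) (power xs d)) ⟩
      sumMap (λ x → count (λ u → (a =ᵇ x) ∧ (w MV.=ᵇ u)) (power xs d)) xs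
    ≡⟨ sumMap-cong xs (λ x → sumMap-cong (power xs d) (λ u → iverson-∧ (a =ᵇ x) (w MV.=ᵇ u))) ⟩
      sumMap (λ x → sumMap (λ u → iverson (a =ᵇ x) * iverson (w MV.=ᵇ u)) (power xs d)) xs
    ≡⟨ sumMap-cong xs (λ x → *-distribˡ-sumMap (iverson (a =ᵇ x)) _ (power xs d)) ⟨
      sumMap (λ x → iverson (a =ᵇ x) * MV.mult w (power xs d)) xs
    ≡⟨ *-distribʳ-sumMap (MV.mult w (power xs d)) _ xs ⟨
      mult a xs * MV.mult w (power xs d) ∎
    where open ≡-Reasoning

  power-enumeration : (xs : List A) → IsEnumeration xs → (d : ℕ) → MV.IsEnumeration (power xs d)
  power-enumeration xs enum zero    []      = refl
  power-enumeration xs enum (suc d) (a ∷ w) =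
    trans (mult-power xs d a w) (cong₂ _*_ (enum a) (power-enumeration xs enum d w))

  power-occurs : (xs : List A) {d : ℕ} (v : Vec A d) → All (λ a → 1 ≤ mult a xs) v → 1 ≤ MV.mult v (power xs d)
  power-occurs xs []      []         = ℕₚ.≤-refl
  power-occurs xs {suc d} (a ∷ v) (a∈ ∷ v∈) =
    subst (1 ≤_) (sym (mult-power xs d a v)) (ℕₚ.*-mono-≤ a∈ (power-occurs xs v v∈))

  power-occurs⁻ : (xs : List A) {d : ℕ} (v : Vec A d) → 1 ≤ MV.mult v (power xs d) → All (λ a → 1 ≤ mult a xs) v
  power-occurs⁻ xs []      _   = []
  power-occurs⁻ xs {suc d} (a ∷ v) av∈ =
    1≤*ˡ av∈′ ∷ power-occurs⁻ xs v (1≤*ˡ (subst (1 ≤_) (ℕₚ.*-comm (mult a xs) _) av∈′))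
    where
    av∈′ : 1 ≤ mult a xs * MV.mult v (power xs d)
    av∈′ = subst (1 ≤_) (mult-power xs d a v) av∈
    1≤*ˡ : ∀ {m n} → 1 ≤ m * n → 1 ≤ m
    1≤*ˡ {suc m} _ = s≤s z≤n

  length-power : (xs : List A) (d : ℕ) → length (power xs d) ≡ length xs ^ d
  length-power xs zero    = refl
  length-power xs (suc d) = begin
      length (concatMap (λ x → map (x ∷_) (power xs d)) xs)
    ≡⟨ count-true (concatMap (λ x → map (x ∷_) (power xs d)) xs) ⟨
      count (λ _ → true) (concatMap (λ x → map (x ∷_) (power xs d)) xs)
    ≡⟨ sumMap-concatMap _ _ xs ⟩
      sumMap (λ x → count (λ _ → true) (map (x ∷_) (power xs d))) xs
    ≡⟨ sumMap-cong xs (λ x → trans (count-true (map (x ∷_) (power xs d)))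
                                    (trans (Listₚ.length-map (x ∷_) (power xs d)) (length-power xs d))) ⟩
      sumMap (λ _ → length xs ^ d) xs
    ≡⟨ sumMap-const _ xs ⟩
      length xs * length xs ^ d ∎
    where open ≡-Reasoning

module Pick {A : Set} (_≟_ : DecidableEquality A) {c ℓ} (S : CommutativeSemiring c ℓ) where

  open import Data.List using (List; []; _∷_)
  open import Relation.Nullary using (yes; no)
  import Relation.Binary.PropositionalEquality as ≡
  open CommutativeSemiring S
  open Sums S using (sumMap; iverson)
  open Multiplicity _≟_ using (mult; _=ᵇ_)

  sumMap-absent : (h : A → Carrier) (a : A) (xs : List A) → mult a xs ≡ 0 → sumMap (λ x → h x * iverson (a =ᵇ x)) xs ≈ 0#
  sumMap-absent h a []       _  = refl
  sumMap-absent h a (x ∷ xs) a∉ with a ≟ x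
  ... | no _ = trans (+-cong (zeroʳ (h x)) (sumMap-absent h a xs a∉)) (+-identityˡ 0#)

  sumMap-pick : (h : A → Carrier) (a : A) (xs : List A) → mult a xs ≡ 1 → sumMap (λ x → h x * iverson (a =ᵇ x)) xs ≈ h a
  sumMap-pick h a (x ∷ xs) a∈! with a ≟ x
  ... | yes ≡.refl = trans (+-cong (*-identityʳ (h a)) (sumMap-absent h a xs (Data.Nat.Properties.suc-injective a∈!))) (+-identityʳ (h a))
    where import Data.Nat.Properties
  ... | no _       = trans (+-cong (zeroʳ (h x)) (sumMap-pick h a xs a∈!)) (+-identityˡ (h a))

module PowerCancellation (q : ℕ) (1<q : Data.Nat._<_ 1 q) where

  open import Data.Nat using (_^_; _≤_)
  import Data.Nat.Properties as ℕₚ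
  open import Data.Empty using (⊥-elim)
  open import Relation.Nullary using (yes; no)
  open import Relation.Binary.PropositionalEquality using (sym)

  ^-cancelʳ-≤ : ∀ a b → q ^ a ≤ q ^ b → a ≤ b
  ^-cancelʳ-≤ a b q^a≤q^b with a ℕₚ.≤? b
  ... | yes a≤b = a≤b
  ... | no  a≰b = ⊥-elim (ℕₚ.<⇒≱ (ℕₚ.^-monoʳ-< q 1<q (ℕₚ.≰⇒> a≰b)) q^a≤q^b)

  ^-injective : ∀ a b → q ^ a ≡ q ^ b → a ≡ b
  ^-injective a b e = ℕₚ.≤-antisym (^-cancelʳ-≤ a b (ℕₚ.≤-reflexive e)) (^-cancelʳ-≤ b a (ℕₚ.≤-reflexive (sym e)))

module GaussianBinomial (q : ℕ) (1<q : Data.Nat._<_ 1 q) where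

  open import Data.Nat using (zero; suc; _+_; _*_; _∸_; _^_; _≤_; _<_; z≤n; s≤s; NonZero; >-nonZero)
  open import Data.Nat.Properties
  open import Data.Sum using (inj₁; inj₂)
  open import Data.Empty using (⊥-elim)
  open import Relation.Nullary using (yes; no)
  open import Relation.Binary.PropositionalEquality
  open import Data.Nat.Solver using (module +-*-Solver)
  open +-*-Solver
  open import Algebra.Properties.CommutativeSemigroup *-commutativeSemigroup using (x∙yz≈y∙xz)

  -- frames t s r = (q^t - q^s)(q^t - q^(s+1))⋯(q^t - q^(s+r-1)): the number of ways to extend s
  -- independent vectors of a t-dimensional space by r further vectors, keeping independence.
  frames : ℕ → ℕ → ℕ → ℕ
  frames t s zero    = 1
  frames t s (suc r) = (q ^ t ∸ q ^ s) * frames t (suc s) r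

  instance
    q-nonZero : NonZero q
    q-nonZero = >-nonZero (<-trans (s≤s z≤n) 1<q)

  frames-snoc : ∀ t s r → frames t s (suc r) ≡ frames t s r * (q ^ t ∸ q ^ (s + r))
  frames-snoc t s zero    rewrite +-identityʳ s = trans (*-identityʳ _) (sym (*-identityˡ _))
  frames-snoc t s (suc r) rewrite frames-snoc t (suc s) r | +-suc s r =
    sym (*-assoc (q ^ t ∸ q ^ s) (frames t (suc s) r) _)

  frames-shift : ∀ d t s r → frames (d + t) (d + s) r ≡ q ^ (d * r) * frames t s r
  frames-shift d t s zero    rewrite *-zeroʳ d = refl
  frames-shift d t s (suc r) = begin
      (q ^ (d + t) ∸ q ^ (d + s)) * frames (d + t) (suc (d + s)) r
    ≡⟨ cong₂ (λ a b → (a ∸ b) * frames (d + t) (suc (d + s)) r) (^-distribˡ-+-* q d t) (^-distribˡ-+-* q d s) ⟩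
      (q ^ d * q ^ t ∸ q ^ d * q ^ s) * frames (d + t) (suc (d + s)) r
    ≡⟨ cong₂ _*_ (sym (*-distribˡ-∸ (q ^ d) (q ^ t) (q ^ s))) (cong (λ z → frames (d + t) z r) (sym (+-suc d s))) ⟩
      q ^ d * (q ^ t ∸ q ^ s) * frames (d + t) (d + suc s) r
    ≡⟨ cong (q ^ d * (q ^ t ∸ q ^ s) *_) (frames-shift d t (suc s) r) ⟩
      q ^ d * (q ^ t ∸ q ^ s) * (q ^ (d * r) * frames t (suc s) r)
    ≡⟨ solve 4 (λ A B C D → (A :* B) :* (C :* D) := (A :* C) :* (B :* D)) refl (q ^ d) _ (q ^ (d * r)) _ ⟩
      q ^ d * q ^ (d * r) * ((q ^ t ∸ q ^ s) * frames t (suc s) r)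
    ≡⟨ cong (_* ((q ^ t ∸ q ^ s) * frames t (suc s) r))
            (trans (sym (^-distribˡ-+-* q d (d * r))) (cong (q ^_) (sym (*-suc d r)))) ⟩
      q ^ (d * suc r) * ((q ^ t ∸ q ^ s) * frames t (suc s) r) ∎
    where open ≡-Reasoning

  frames-≡0 : ∀ t s r → s ≤ t → t < s + r → frames t s r ≡ 0
  frames-≡0 t s zero    s≤t t<s rewrite +-identityʳ s = ⊥-elim (<⇒≱ t<s s≤t)
  frames-≡0 t s (suc r) s≤t t<s+r with m≤n⇒m<n∨m≡n s≤t
  ... | inj₂ refl = cong (_* frames t (suc t) r) (n∸n≡0 (q ^ t))
  ... | inj₁ s<t  = trans (cong ((q ^ t ∸ q ^ s) *_) (frames-≡0 t (suc s) r s<t (subst (t <_) (+-suc s r) t<s+r)))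
                          (*-zeroʳ (q ^ t ∸ q ^ s))

  frames-nonZero : ∀ t s r → s + r ≤ t → NonZero (frames t s r)
  frames-nonZero t s zero    _       = _
  frames-nonZero t s (suc r) s+r≤t = m*n≢0 (q ^ t ∸ q ^ s) _
    {{>-nonZero (m<n⇒0<n∸m (^-monoʳ-< q 1<q s<t))}}
    {{frames-nonZero t (suc s) r (subst (_≤ t) (+-suc s r) s+r≤t)}}
    where
    s<t : s < t
    s<t = <-≤-trans (s≤s (m≤m+n s r)) (subst (_≤ t) (+-suc s r) s+r≤t)

  frames-suc : ∀ t r → frames (suc t) 1 r ≡ q ^ r * frames t 0 r
  frames-suc t r = trans (frames-shift 1 t 0 r) (cong (λ e → q ^ e * frames t 0 r) (*-identityˡ r))

  q-telescope : ∀ {a b} → b ≤ a → (q ^ suc b ∸ 1) + q * (q ^ a ∸ q ^ b) ≡ q ^ suc a ∸ 1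
  q-telescope {a} {b} b≤a = begin
      (q ^ suc b ∸ 1) + q * (q ^ a ∸ q ^ b)  ≡⟨ cong ((q ^ suc b ∸ 1) +_) (*-distribˡ-∸ q (q ^ a) (q ^ b)) ⟩
      (q ^ suc b ∸ 1) + (q ^ suc a ∸ q ^ suc b) ≡⟨ ∸-telescope (m^n>0 q (suc b)) (^-monoʳ-≤ q (s≤s b≤a)) ⟩
      q ^ suc a ∸ 1 ∎
    where
    open ≡-Reasoning
    ∸-telescope : ∀ {x y} → 1 ≤ x → x ≤ y → (x ∸ 1) + (y ∸ x) ≡ y ∸ 1
    ∸-telescope {suc x} {suc y} _ (s≤s x≤y) = m+[n∸m]≡n x≤y

  frames-telescope : ∀ a b → frames a 0 b * ((q ^ suc b ∸ 1) + q * (q ^ a ∸ q ^ b)) ≡ frames a 0 b * (q ^ suc a ∸ 1)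
  frames-telescope a b with b ≤? a
  ... | yes b≤a = cong (frames a 0 b *_) (q-telescope b≤a)
  ... | no  b≰a rewrite frames-≡0 a 0 b z≤n (≰⇒> b≰a) = refl

  -- [a choose r]_q counts r-dimensional subspaces of F_q^a, each carrying frames r 0 r ordered bases.
  gauss-frames : ∀ a r → gauss q a r * frames r 0 r ≡ frames a 0 r
  gauss-frames a       zero    = refl
  gauss-frames zero    (suc b) = refl
  gauss-frames (suc a) (suc b) = begin
      (gauss q a b + q ^ suc b * gauss q a (suc b)) * (X * frames (suc b) 1 b)
    ≡⟨ cong (λ z → (gauss q a b + q ^ suc b * gauss q a (suc b)) * (X * z)) (frames-suc b b) ⟩
      (gauss q a b + q ^ suc b * gauss q a (suc b)) * (X * (q ^ b * G))
    ≡⟨ solve 6 (λ A B C D E F → (A :+ B :* C) :* (D :* (E :* F)) := D :* E :* (A :* F) :+ B :* (C :* (D :* (E :* F))))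
             refl (gauss q a b) (q ^ suc b) (gauss q a (suc b)) X (q ^ b) G ⟩
      X * q ^ b * (gauss q a b * G) + q ^ suc b * (gauss q a (suc b) * (X * (q ^ b * G)))
    ≡⟨ cong₂ (λ s t → X * q ^ b * s + q ^ suc b * t) (gauss-frames a b)
             (trans (cong (λ z → gauss q a (suc b) * (X * z)) (sym (frames-suc b b))) (gauss-frames a (suc b))) ⟩
      X * q ^ b * g + q ^ suc b * frames a 0 (suc b)
    ≡⟨ cong (λ t → X * q ^ b * g + q ^ suc b * t) (frames-snoc a 0 b) ⟩
      X * q ^ b * g + q * q ^ b * (g * (q ^ a ∸ q ^ b))
    ≡⟨ solve 5 (λ A B C Q D → A :* B :* C :+ Q :* B :* (C :* D) := B :* (C :* (A :+ Q :* D))) refl X (q ^ b) g q _ ⟩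
      q ^ b * (g * (X + q * (q ^ a ∸ q ^ b)))
    ≡⟨ cong (q ^ b *_) (frames-telescope a b) ⟩
      q ^ b * (g * (q ^ suc a ∸ 1))
    ≡⟨ solve 3 (λ A B C → A :* (B :* C) := C :* (A :* B)) refl (q ^ b) g _ ⟩
      (q ^ suc a ∸ 1) * (q ^ b * g)
    ≡⟨ cong ((q ^ suc a ∸ 1) *_) (frames-suc a b) ⟨
      (q ^ suc a ∸ 1) * frames (suc a) 1 b ∎
    where
    open ≡-Reasoning
    X G g : ℕ
    X = q ^ suc b ∸ 1
    G = frames b 0 b
    g = frames a 0 b

  frames-from : ∀ d t r → frames (d + t) d r ≡ q ^ (d * r) * frames t 0 r
  frames-from d t r = trans (cong (λ s → frames (d + t) s r) (sym (+-identityʳ d))) (frames-shift d t 0 r)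

  gauss-extensions : ∀ d a r → gauss q a r * frames (d + r) d r ≡ frames (d + a) d r
  gauss-extensions d a r = begin
      gauss q a r * frames (d + r) d r           ≡⟨ cong (gauss q a r *_) (frames-from d r r) ⟩
      gauss q a r * (q ^ (d * r) * frames r 0 r) ≡⟨ x∙yz≈y∙xz (gauss q a r) (q ^ (d * r)) _ ⟩
      q ^ (d * r) * (gauss q a r * frames r 0 r) ≡⟨ cong (q ^ (d * r) *_) (gauss-frames a r) ⟩
      q ^ (d * r) * frames a 0 r                 ≡⟨ frames-from d a r ⟨
      frames (d + a) d r                         ∎
    where open ≡-Reasoning

  gauss-unique : ∀ d a r c → c * frames (d + r) d r ≡ frames (d + a) d r → c ≡ gauss q a r
  gauss-unique d a r c e = *-cancelʳ-≡ c (gauss q a r) (frames (d + r) d r)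
    {{frames-nonZero (d + r) d r ≤-refl}} (trans e (sym (gauss-extensions d a r)))

module VectorSpace (𝔽 : FiniteField) (n : ℕ) where

  open import Data.Bool using (Bool; _∨_)
  open import Data.Nat using (zero; suc; _<_) renaming (_+_ to _+ℕ_)
  import Data.Nat.Properties as ℕₚ
  open import Data.Vec using (Vec; []; _∷_; _++_)
  import Data.Vec.Properties as Vecₚ
  open import Data.Empty using (⊥-elim)
  open import Relation.Nullary using (yes; no)
  open import Relation.Binary.PropositionalEquality
  open ℕSums using (count; sumMap-cong; count≤length)

  open FiniteField 𝔽 hiding (_+_; _*_; -_)
  open Space 𝔽 n

  𝔽-ring : CommutativeRing 0ℓ 0ℓ
  𝔽-ring = record { isCommutativeRing = isCommutativeRing }

  open CommutativeRing 𝔽-ring using (_+_; _*_; -_; +-assoc; +-comm; *-assoc; *-comm; +-identityˡ; +-identityʳ; *-identityˡ;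
    distribˡ; distribʳ; -‿inverseʳ; zeroˡ; zeroʳ; ring)
  open import Algebra.Properties.Ring ring using (-1*x≈-x; -‿involutive)

  module Mᶠ = Multiplicity _≟_

  elems-enumeration : Mᶠ.IsEnumeration elems
  elems-enumeration a = Mᶠ.Unique⇒mult≡1 a elems (complete a) unique

  1<q : 1 < q
  1<q = ℕₚ.≤-trans (ℕₚ.≤-reflexive (sym two-elements)) (count≤length is-0-or-1 elems)
    where
    is-0-or-1 : Carrier → Bool
    is-0-or-1 a = (0# Mᶠ.=ᵇ a) ∨ (1# Mᶠ.=ᵇ a)
    split : ∀ a → ℕSums.iverson (is-0-or-1 a) ≡ ℕSums.iverson (0# Mᶠ.=ᵇ a) +ℕ ℕSums.iverson (1# Mᶠ.=ᵇ a)
    split a with 0# ≟ a | 1# ≟ a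
    ... | yes refl | yes 1≡0 = ⊥-elim (0≢1 (sym 1≡0))
    ... | yes _    | no _    = refl
    ... | no _     | yes _   = refl
    ... | no _     | no _    = refl
    two-elements : count is-0-or-1 elems ≡ 2
    two-elements = trans (sumMap-cong elems split)
      (trans (ℕSums.sumMap-distrib-+ _ _ elems) (cong₂ _+ℕ_ (elems-enumeration 0#) (elems-enumeration 1#)))

  open PowerCancellation q 1<q public

  -1# : Carrier
  -1# = - 1#

  x+-1*x≡0 : ∀ x → x + -1# * x ≡ 0#
  x+-1*x≡0 x = trans (cong (x +_) (-1*x≈-x x)) (-‿inverseʳ x)

  x+y≡0⇒x≡-1*y : ∀ x y → x + y ≡ 0# → x ≡ -1# * y
  x+y≡0⇒x≡-1*y x y x+y≡0 = begin
      x                     ≡⟨ +-identityʳ x ⟨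
      x + 0#                ≡⟨ cong (x +_) (x+-1*x≡0 y) ⟨
      x + (y + -1# * y)     ≡⟨ +-assoc x y _ ⟨
      (x + y) + -1# * y     ≡⟨ cong (_+ -1# * y) x+y≡0 ⟩
      0# + -1# * y          ≡⟨ +-identityˡ _ ⟩
      -1# * y               ∎
    where open ≡-Reasoning

  -1*-1≡1 : -1# * -1# ≡ 1#
  -1*-1≡1 = trans (-1*x≈-x -1#) (-‿involutive 1#)

  +ᵥ-assoc : ∀ {m} (u v w : Vec Carrier m) → (u +ᵥ v) +ᵥ w ≡ u +ᵥ (v +ᵥ w)
  +ᵥ-assoc = Vecₚ.zipWith-assoc +-assoc

  +ᵥ-comm : ∀ {m} (u v : Vec Carrier m) → u +ᵥ v ≡ v +ᵥ u
  +ᵥ-comm = Vecₚ.zipWith-comm +-comm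

  +ᵥ-identityˡ : ∀ {m} (u : Vec Carrier m) → 0ᵥ +ᵥ u ≡ u
  +ᵥ-identityˡ = Vecₚ.zipWith-identityˡ +-identityˡ

  +ᵥ-identityʳ : ∀ {m} (u : Vec Carrier m) → u +ᵥ 0ᵥ ≡ u
  +ᵥ-identityʳ = Vecₚ.zipWith-identityʳ +-identityʳ

  ∙ᵥ-distribˡ : ∀ {m} c (u v : Vec Carrier m) → c ∙ᵥ (u +ᵥ v) ≡ (c ∙ᵥ u) +ᵥ (c ∙ᵥ v)
  ∙ᵥ-distribˡ c []      []      = refl
  ∙ᵥ-distribˡ c (a ∷ u) (b ∷ v) = cong₂ _∷_ (distribˡ c a b) (∙ᵥ-distribˡ c u v)

  ∙ᵥ-distribʳ : ∀ {m} a b (u : Vec Carrier m) → (a + b) ∙ᵥ u ≡ (a ∙ᵥ u) +ᵥ (b ∙ᵥ u)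
  ∙ᵥ-distribʳ a b []      = refl
  ∙ᵥ-distribʳ a b (x ∷ u) = cong₂ _∷_ (distribʳ x a b) (∙ᵥ-distribʳ a b u)

  ∙ᵥ-assoc : ∀ {m} a b (u : Vec Carrier m) → (a * b) ∙ᵥ u ≡ a ∙ᵥ (b ∙ᵥ u)
  ∙ᵥ-assoc a b []      = refl
  ∙ᵥ-assoc a b (x ∷ u) = cong₂ _∷_ (*-assoc a b x) (∙ᵥ-assoc a b u)

  ∙ᵥ-identity : ∀ {m} (u : Vec Carrier m) → 1# ∙ᵥ u ≡ u
  ∙ᵥ-identity []      = refl
  ∙ᵥ-identity (x ∷ u) = cong₂ _∷_ (*-identityˡ x) (∙ᵥ-identity u)

  ∙ᵥ-zeroˡ : ∀ {m} (u : Vec Carrier m) → 0# ∙ᵥ u ≡ 0ᵥ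
  ∙ᵥ-zeroˡ []      = refl
  ∙ᵥ-zeroˡ (x ∷ u) = cong₂ _∷_ (zeroˡ x) (∙ᵥ-zeroˡ u)

  ∙ᵥ-zeroʳ : ∀ {m} c → c ∙ᵥ 0ᵥ {m} ≡ 0ᵥ
  ∙ᵥ-zeroʳ {zero}  c = refl
  ∙ᵥ-zeroʳ {suc m} c = cong₂ _∷_ (zeroʳ c) (∙ᵥ-zeroʳ {m} c)

  u-u≡0 : ∀ {m} (u : Vec Carrier m) → u +ᵥ (-1# ∙ᵥ u) ≡ 0ᵥ
  u-u≡0 []      = refl
  u-u≡0 (x ∷ u) = cong₂ _∷_ (x+-1*x≡0 x) (u-u≡0 u)

  u+v≡0⇒u≡-v : ∀ {m} (u v : Vec Carrier m) → u +ᵥ v ≡ 0ᵥ → u ≡ -1# ∙ᵥ v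
  u+v≡0⇒u≡-v []      []      _ = refl
  u+v≡0⇒u≡-v (a ∷ u) (b ∷ v) e =
    cong₂ _∷_ (x+y≡0⇒x≡-1*y a b (Vecₚ.∷-injectiveˡ e)) (u+v≡0⇒u≡-v u v (Vecₚ.∷-injectiveʳ e))

  u-v≡0⇒u≡v : ∀ {m} (u v : Vec Carrier m) → u +ᵥ (-1# ∙ᵥ v) ≡ 0ᵥ → u ≡ v
  u-v≡0⇒u≡v u v e = begin
      u                    ≡⟨ u+v≡0⇒u≡-v u _ e ⟩
      -1# ∙ᵥ (-1# ∙ᵥ v)    ≡⟨ ∙ᵥ-assoc -1# -1# v ⟨
      (-1# * -1#) ∙ᵥ v     ≡⟨ cong (_∙ᵥ v) -1*-1≡1 ⟩
      1# ∙ᵥ v              ≡⟨ ∙ᵥ-identity v ⟩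
      v                    ∎
    where open ≡-Reasoning

  +ᵥ-interchange : ∀ {m} (a b c d : Vec Carrier m) → (a +ᵥ b) +ᵥ (c +ᵥ d) ≡ (a +ᵥ c) +ᵥ (b +ᵥ d)
  +ᵥ-interchange a b c d = begin
      (a +ᵥ b) +ᵥ (c +ᵥ d)  ≡⟨ +ᵥ-assoc a b (c +ᵥ d) ⟩
      a +ᵥ (b +ᵥ (c +ᵥ d))  ≡⟨ cong (a +ᵥ_) (+ᵥ-assoc b c d) ⟨
      a +ᵥ ((b +ᵥ c) +ᵥ d)  ≡⟨ cong (λ z → a +ᵥ (z +ᵥ d)) (+ᵥ-comm b c) ⟩
      a +ᵥ ((c +ᵥ b) +ᵥ d)  ≡⟨ cong (a +ᵥ_) (+ᵥ-assoc c b d) ⟩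
      a +ᵥ (c +ᵥ (b +ᵥ d))  ≡⟨ +ᵥ-assoc a c (b +ᵥ d) ⟨
      (a +ᵥ c) +ᵥ (b +ᵥ d)  ∎
    where open ≡-Reasoning

  lincomb-+ : ∀ {d} (a b : Vec Carrier d) (ws : Vec E d) → lincomb (a +ᵥ b) ws ≡ lincomb a ws +ᵥ lincomb b ws
  lincomb-+ []      []      []       = sym (+ᵥ-identityˡ 0ᵥ)
  lincomb-+ (x ∷ a) (y ∷ b) (w ∷ ws) =
    trans (cong₂ _+ᵥ_ (∙ᵥ-distribʳ x y w) (lincomb-+ a b ws)) (+ᵥ-interchange _ _ _ _)

  lincomb-∙ : ∀ {d} c (a : Vec Carrier d) (ws : Vec E d) → lincomb (c ∙ᵥ a) ws ≡ c ∙ᵥ lincomb a ws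
  lincomb-∙ c []      []       = sym (∙ᵥ-zeroʳ c)
  lincomb-∙ c (x ∷ a) (w ∷ ws) = trans (cong₂ _+ᵥ_ (∙ᵥ-assoc c x w) (lincomb-∙ c a ws)) (sym (∙ᵥ-distribˡ c _ _))

  lincomb-0 : ∀ {d} (ws : Vec E d) → lincomb 0ᵥ ws ≡ 0ᵥ
  lincomb-0 []       = refl
  lincomb-0 (w ∷ ws) = trans (cong₂ _+ᵥ_ (∙ᵥ-zeroˡ w) (lincomb-0 ws)) (+ᵥ-identityˡ 0ᵥ)

  lincomb-++ : ∀ {r s} (a : Vec Carrier r) (b : Vec Carrier s) (us : Vec E r) (ws : Vec E s) →
               lincomb (a ++ b) (us ++ ws) ≡ lincomb a us +ᵥ lincomb b ws
  lincomb-++ []      b []       ws = sym (+ᵥ-identityˡ _)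
  lincomb-++ (x ∷ a) b (u ∷ us) ws = trans (cong ((x ∙ᵥ u) +ᵥ_) (lincomb-++ a b us ws)) (sym (+ᵥ-assoc _ _ _))

  lincomb-0∷ : ∀ {s} (u : E) (ws : Vec E s) c → lincomb (0# ∷ c) (u ∷ ws) ≡ lincomb c ws
  lincomb-0∷ u ws c = trans (cong (_+ᵥ lincomb c ws) (∙ᵥ-zeroˡ u)) (+ᵥ-identityˡ _)

  lincomb-1∷0 : ∀ {s} (u : E) (ws : Vec E s) → lincomb (1# ∷ 0ᵥ) (u ∷ ws) ≡ u
  lincomb-1∷0 u ws = trans (cong₂ _+ᵥ_ (∙ᵥ-identity u) (lincomb-0 ws)) (+ᵥ-identityʳ u)

  0ᵥ-++ : ∀ r s → 0ᵥ {r +ℕ s} ≡ 0ᵥ {r} ++ 0ᵥ {s}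
  0ᵥ-++ zero    s = refl
  0ᵥ-++ (suc r) s = cong (0# ∷_) (0ᵥ-++ r s)

  Independent : ∀ {d} → Vec E d → Set
  Independent ws = ∀ c → lincomb c ws ≡ 0ᵥ → c ≡ 0ᵥ

  Independent-[] : Independent []
  Independent-[] [] _ = refl

  lincomb-injective : ∀ {d} (ws : Vec E d) → Independent ws → ∀ a b → lincomb a ws ≡ lincomb b ws → a ≡ b
  lincomb-injective ws ind a b e = u-v≡0⇒u≡v a b (ind _ (begin
      lincomb (a +ᵥ (-1# ∙ᵥ b)) ws              ≡⟨ lincomb-+ a _ ws ⟩
      lincomb a ws +ᵥ lincomb (-1# ∙ᵥ b) ws     ≡⟨ cong (lincomb a ws +ᵥ_) (lincomb-∙ -1# b ws) ⟩
      lincomb a ws +ᵥ (-1# ∙ᵥ lincomb b ws)     ≡⟨ cong (λ z → z +ᵥ (-1# ∙ᵥ lincomb b ws)) e ⟩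
      lincomb b ws +ᵥ (-1# ∙ᵥ lincomb b ws)     ≡⟨ u-u≡0 _ ⟩
      0ᵥ                                         ∎))
    where open ≡-Reasoning

  Independent-∷ : ∀ {d} (u : E) (ws : Vec E d) → Independent ws → (∀ c → u ≢ lincomb c ws) → Independent (u ∷ ws)
  Independent-∷ u ws ind u∉ (a ∷ c) e with a ≟ 0#
  ... | yes refl = cong (0# ∷_) (ind c (trans (sym (lincomb-0∷ u ws c)) e))
  ... | no a≢0 with inverse a a≢0
  ...   | b , a*b≡1 = ⊥-elim (u∉ ((b * -1#) ∙ᵥ c) (begin
      u                          ≡⟨ ∙ᵥ-identity u ⟨
      1# ∙ᵥ u                    ≡⟨ cong (_∙ᵥ u) (trans (*-comm b a) a*b≡1) ⟨
      (b * a) ∙ᵥ u               ≡⟨ ∙ᵥ-assoc b a u ⟩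
      b ∙ᵥ (a ∙ᵥ u)              ≡⟨ cong (b ∙ᵥ_) (u+v≡0⇒u≡-v _ _ e) ⟩
      b ∙ᵥ (-1# ∙ᵥ lincomb c ws) ≡⟨ ∙ᵥ-assoc b -1# _ ⟨
      (b * -1#) ∙ᵥ lincomb c ws  ≡⟨ lincomb-∙ (b * -1#) c ws ⟨
      lincomb ((b * -1#) ∙ᵥ c) ws ∎))
    where open ≡-Reasoning

  Independent-++ˡ : ∀ {r s} (us : Vec E r) (ws : Vec E s) → Independent (us ++ ws) → Independent us
  Independent-++ˡ {r} {s} us ws ind a e = Vecₚ.++-injectiveˡ a 0ᵥ (trans (ind (a ++ 0ᵥ) lc≡0) (0ᵥ-++ r s))
    where
    lc≡0 : lincomb (a ++ 0ᵥ) (us ++ ws) ≡ 0ᵥ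
    lc≡0 = trans (lincomb-++ a 0ᵥ us ws) (trans (cong₂ _+ᵥ_ e (lincomb-0 ws)) (+ᵥ-identityˡ 0ᵥ))

module Subspaces (𝔽 : FiniteField) (n : ℕ) where

  open import Data.Bool using (Bool; true; false; _∧_; _∨_; not)
  open import Data.Bool.ListAction using (all; any)
  open import Data.Nat using (zero; suc; _≤_; _<_; _^_; z≤n) renaming (_+_ to _+ℕ_)
  import Data.Nat.Properties as ℕₚ
  open import Data.List using (List; []; _∷_; map; length)
  import Data.List.Properties as Listₚ
  open import Data.Vec as Vec using (Vec; []; _∷_; _++_)
  import Data.Vec.Properties as Vecₚ
  open import Data.Vec.Relation.Unary.All as All using (All; []; _∷_)
  open import Data.Sum using (inj₁; inj₂)
  open import Data.Empty using (⊥-elim)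
  open import Relation.Binary.PropositionalEquality
  open ℕSums using (count; sumMap-cong; count-true; count≤length)
  open Counting using (count-mono)
  open Booleans

  open FiniteField 𝔽 hiding (_+_; _*_; -_)
  open Space 𝔽 n
  open VectorSpace 𝔽 n public
  open CommutativeRing 𝔽-ring using (_*_)

  module Mᵛ {m : ℕ} = Multiplicity (Vecₚ.≡-dec {n = m} _≟_)
  module Pᶠ = Powers _≟_

  infix 4 _∈ˢ_ _⊆ˢ_
  _∈ˢ_ : E → Subset → Set
  v ∈ˢ S = member v S ≡ true

  _⊆ˢ_ : Subset → Subset → Set
  V ⊆ˢ W = ∀ v → v ∈ˢ V → v ∈ˢ W

  vecs-enumeration : Mᵛ.IsEnumeration vecs
  vecs-enumeration = Pᶠ.power-enumeration elems elems-enumeration n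

  length-vecs : Nₑ ≡ q ^ n
  length-vecs = Pᶠ.length-power elems n

  member-map : (P : E → Bool) (v : E) → member v (map P vecs) ≡ P v
  member-map P v = Mᵛ.memberOf-map vecs v P (vecs-enumeration v)

  member-full : ∀ v → v ∈ˢ fullSpace
  member-full v = Mᵛ.memberOf-replicate vecs v (vecs-enumeration v)

  Subset-ext : (S S′ : Subset) → length S ≡ Nₑ → length S′ ≡ Nₑ → (∀ v → member v S ≡ member v S′) → S ≡ S′
  Subset-ext S S′ ∣S∣ ∣S′∣ = Mᵛ.memberOf-ext vecs S S′ ∣S∣ ∣S′∣ (λ v → ℕₚ.≤-reflexive (vecs-enumeration v))

  ⊆ᵇ-sound : ∀ {V W} → (V ⊆ᵇ W) ≡ true → V ⊆ˢ W
  ⊆ᵇ-sound V⊆W v = ⇒ᵇ-elim (Mᵛ.all-true-enum _ vecs vecs-enumeration V⊆W v)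

  ⊆ᵇ-complete : ∀ {V W} → V ⊆ˢ W → (V ⊆ᵇ W) ≡ true
  ⊆ᵇ-complete V⊆W = all-true⁺ _ vecs (λ v → ⇒ᵇ-intro (V⊆W v))

  record Subspace (S : Subset) : Set where
    field
      length≡  : length S ≡ Nₑ
      0∈       : 0ᵥ ∈ˢ S
      +-closed : ∀ u w → u ∈ˢ S → w ∈ˢ S → (u +ᵥ w) ∈ˢ S
      ∙-closed : ∀ c u → u ∈ˢ S → (c ∙ᵥ u) ∈ˢ S

  isSubspaceᵇ⇒Subspace : ∀ {S} → isSubspaceᵇ S ≡ true → Subspace S
  isSubspaceᵇ⇒Subspace {S} e
    with ∣S∣ , e₁ ← ∧-true⁻ e
    with 0∈ , e₂ ← ∧-true⁻ e₁
    with +-closed , ∙-closed ← ∧-true⁻ e₂ = record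
    { length≡  = ≡ᵇ-sound ∣S∣
    ; 0∈       = 0∈
    ; +-closed = λ u w u∈ w∈ → ⇒ᵇ-elim (all-vecs (all-vecs +-closed u) w) (∧-true u∈ w∈)
    ; ∙-closed = λ c u u∈ → ⇒ᵇ-elim (all-vecs (Mᶠ.all-true-enum _ elems elems-enumeration ∙-closed c) u) u∈
    }
    where
    all-vecs : ∀ {p} → all p vecs ≡ true → ∀ v → p v ≡ true
    all-vecs {p} = Mᵛ.all-true-enum p vecs vecs-enumeration

  Subspace⇒isSubspaceᵇ : ∀ {S} → Subspace S → isSubspaceᵇ S ≡ true
  Subspace⇒isSubspaceᵇ {S} sub = ∧-true (≡ᵇ-complete length≡) (∧-true 0∈ (∧-true
    (all-true⁺ _ vecs (λ u → all-true⁺ _ vecs (λ w → ⇒ᵇ-intro (λ h → +-closed u w (∧-trueˡ h) (∧-trueʳ {member u S} h)))))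
    (all-true⁺ _ elems (λ c → all-true⁺ _ vecs (λ u → ⇒ᵇ-intro (∙-closed c u))))))
    where open Subspace sub

  independent-sound : ∀ {d} (ws : Vec E d) → independent ws ≡ true → Independent ws
  independent-sound {d} ws e c lc≡0 = Mᵛ.=ᵇ-sound (⇒ᵇ-elim (all-coeffs e c) (subst (λ z → (z == 0ᵥ) ≡ true) (sym lc≡0) (Mᵛ.=ᵇ-refl {n} 0ᵥ)))
    where all-coeffs = Mᵛ.all-true-enum _ (power elems d) (Pᶠ.power-enumeration elems elems-enumeration d)

  independent-complete : ∀ {d} (ws : Vec E d) → Independent ws → independent ws ≡ true
  independent-complete {d} ws ind = all-true⁺ _ (power elems d)
    (λ c → ⇒ᵇ-intro (λ lc≡0 → subst (λ z → (z Mᵛ.=ᵇ 0ᵥ) ≡ true) (sym (ind c (Mᵛ.=ᵇ-sound lc≡0))) (Mᵛ.=ᵇ-refl {d} 0ᵥ)))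

  spanᵇ : ∀ {d} → Vec E d → E → Bool
  spanᵇ {d} ws v = any (λ c → v == lincomb c ws) (power elems d)

  spanᵇ-lincomb : ∀ {d} (ws : Vec E d) c → spanᵇ ws (lincomb c ws) ≡ true
  spanᵇ-lincomb {d} ws c = Mᵛ.any-true-enum (λ c′ → lincomb c ws == lincomb c′ ws) (power elems d)
                             (Pᶠ.power-enumeration elems elems-enumeration d) c (Mᵛ.=ᵇ-refl (lincomb c ws))

  spanᵇ-sound : ∀ {d} (ws : Vec E d) v → spanᵇ ws v ≡ true → ∃ λ c → v ≡ lincomb c ws
  spanᵇ-sound {d} ws v e with Mᵛ.any-true⁻ _ (power elems d) e
  ... | c , _ , v≡ = c , Mᵛ.=ᵇ-sound v≡

  spanᵇ-false : ∀ {d} (ws : Vec E d) v → spanᵇ ws v ≡ false → ∀ c → v ≢ lincomb c ws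
  spanᵇ-false ws v e c refl with () ← trans (sym e) (spanᵇ-lincomb ws c)

  span : ∀ {d} → Vec E d → Subset
  span ws = map (spanᵇ ws) vecs

  lincomb∈span : ∀ {d} (ws : Vec E d) c → lincomb c ws ∈ˢ span ws
  lincomb∈span ws c = trans (member-map (spanᵇ ws) (lincomb c ws)) (spanᵇ-lincomb ws c)

  span⇒lincomb : ∀ {d} (ws : Vec E d) v → v ∈ˢ span ws → ∃ λ c → v ≡ lincomb c ws
  span⇒lincomb ws v v∈ = spanᵇ-sound ws v (trans (sym (member-map (spanᵇ ws) v)) v∈)

  span-subspace : ∀ {d} (ws : Vec E d) → Subspace (span ws)
  span-subspace ws = record
    { length≡  = Listₚ.length-map _ vecs
    ; 0∈       = subst (_∈ˢ span ws) (lincomb-0 ws) (lincomb∈span ws 0ᵥ)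
    ; +-closed = λ u w u∈ w∈ → +-closed′ (span⇒lincomb ws u u∈) (span⇒lincomb ws w w∈)
    ; ∙-closed = λ c u u∈ → ∙-closed′ c (span⇒lincomb ws u u∈)
    }
    where
    +-closed′ : ∀ {u w} → (∃ λ a → u ≡ lincomb a ws) → (∃ λ b → w ≡ lincomb b ws) → (u +ᵥ w) ∈ˢ span ws
    +-closed′ (a , refl) (b , refl) = subst (_∈ˢ span ws) (lincomb-+ a b ws) (lincomb∈span ws (a +ᵥ b))
    ∙-closed′ : ∀ c {u} → (∃ λ a → u ≡ lincomb a ws) → (c ∙ᵥ u) ∈ˢ span ws
    ∙-closed′ c (a , refl) = subst (_∈ˢ span ws) (lincomb-∙ c a ws) (lincomb∈span ws (c ∙ᵥ a))

  lincomb-closed : ∀ {S} → Subspace S → ∀ {d} (ws : Vec E d) → All (_∈ˢ S) ws → ∀ c → lincomb c ws ∈ˢ S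
  lincomb-closed sub []       []          []       = Subspace.0∈ sub
  lincomb-closed sub (w ∷ ws) (w∈ ∷ ws∈) (c ∷ cs) =
    Subspace.+-closed sub (c ∙ᵥ w) (lincomb cs ws) (Subspace.∙-closed sub c w w∈) (lincomb-closed sub ws ws∈ cs)

  span⊆ : ∀ {S} → Subspace S → ∀ {d} (ws : Vec E d) → All (_∈ˢ S) ws → span ws ⊆ˢ S
  span⊆ sub ws ws∈ v v∈ with span⇒lincomb ws v v∈
  ... | c , refl = lincomb-closed sub ws ws∈ c

  Spans : Subset → ∀ {d} → Vec E d → Set
  Spans S ws = ∀ v → v ∈ˢ S → ∃ λ c → v ≡ lincomb c ws

  card : Subset → ℕ
  card S = count (λ v → member v S) vecs

  card-lincomb-image : ∀ {d} (ws : Vec E d) (S : Subset) → Independent ws → Spans S ws →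
                       (∀ c → lincomb c ws ∈ˢ S) → card S ≡ q ^ d
  card-lincomb-image {d} ws S ind S⊆image image⊆S =
    trans (Image.count-image _≟ᶜ_ _≟ᵛ_ (λ c → lincomb c ws) (power elems d) vecs
             (Pᶠ.power-enumeration elems elems-enumeration d) vecs-enumeration (lincomb-injective ws ind)
             (λ v → member v S) (λ v v∈ → Data.Product.map₂ sym (S⊆image v v∈)) image⊆S)
          (Pᶠ.length-power elems d)
    where
    import Data.Product
    _≟ᶜ_ : DecidableEquality (Vec Carrier d)
    _≟ᶜ_ = Vecₚ.≡-dec _≟_
    _≟ᵛ_ : DecidableEquality E
    _≟ᵛ_ = Vecₚ.≡-dec _≟_

  card-span : ∀ {d} (ws : Vec E d) → Independent ws → card (span ws) ≡ q ^ d
  card-span ws ind = card-lincomb-image ws (span ws) ind (span⇒lincomb ws) (lincomb∈span ws)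

  card-mono : ∀ {V W} → V ⊆ˢ W → card V ≤ card W
  card-mono V⊆W = count-mono _ _ vecs V⊆W

  card≤q^n : ∀ S → card S ≤ q ^ n
  card≤q^n S = ℕₚ.≤-trans (count≤length _ vecs) (ℕₚ.≤-reflexive length-vecs)

  Independent⇒≤n : ∀ {d} (ws : Vec E d) → Independent ws → d ≤ n
  Independent⇒≤n ws ind = ^-cancelʳ-≤ _ n (subst (_≤ q ^ n) (card-span ws ind) (card≤q^n (span ws)))

  record Extension (S : Subset) {s} (ws : Vec E s) : Set where
    field
      r             : ℕ
      us            : Vec E r
      isIndependent : Independent (us ++ ws)
      all∈          : All (_∈ˢ S) (us ++ ws)
      spans         : Spans S (us ++ ws)

  -- Greedily prepend vectors of S outside the current span; the fuel never runs out
  -- because an independent family has at most n vectors.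
  extend : (S : Subset) → ∀ {s} (ws : Vec E s) (fuel : ℕ) → ∀ {r} (us : Vec E r) →
           n ≤ (r +ℕ s) +ℕ fuel → Independent (us ++ ws) → All (_∈ˢ S) (us ++ ws) → Extension S ws
  extend S {s} ws fuel {r} us bound ind inside
    with all (λ v → not (member v S) ∨ spanᵇ (us ++ ws) v) vecs in all-spanned
  ... | true  = record { us = us ; isIndependent = ind ; all∈ = inside ; spans = spans }
    where
    spans : Spans S (us ++ ws)
    spans v v∈ = spanᵇ-sound (us ++ ws) v (⇒ᵇ-elim (Mᵛ.all-true-enum _ vecs vecs-enumeration all-spanned v) v∈)
  ... | false with all-false⁻ _ vecs all-spanned
  ...   | v , v-new with ⇒ᵇ-false {member v S} v-new
  ...     | v∈ , v∉span = step fuel bound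
    where
    ind′ : Independent (v ∷ (us ++ ws))
    ind′ = Independent-∷ v (us ++ ws) ind (spanᵇ-false (us ++ ws) v v∉span)
    step : ∀ fuel → n ≤ (r +ℕ s) +ℕ fuel → Extension S ws
    step zero        bound′ = ⊥-elim (ℕₚ.<⇒≱ (Independent⇒≤n _ ind′) (subst (n ≤_) (ℕₚ.+-identityʳ _) bound′))
    step (suc fuel′) bound′ = extend S ws fuel′ (v ∷ us) (subst (n ≤_) (ℕₚ.+-suc _ fuel′) bound′) ind′ (v∈ ∷ inside)

  record Basis (S : Subset) : Set where
    field
      d             : ℕ
      vectors       : Vec E d
      isIndependent : Independent vectors
      all∈          : All (_∈ˢ S) vectors
      spans         : Spans S vectors

  basis : ∀ S → Basis S
  basis S = record { d = r +ℕ 0 ; vectors = us ++ [] ; isIndependent = isIndependent ; all∈ = all∈ ; spans = spans }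
    where open Extension (extend S [] n [] ℕₚ.≤-refl Independent-[] [])

  card-basis : ∀ {S} → Subspace S → (B : Basis S) → card S ≡ q ^ Basis.d B
  card-basis sub B = card-lincomb-image vectors _ isIndependent spans (lincomb-closed sub vectors all∈)
    where open Basis B

  dimFrom-unique : ∀ S N s → s ≤ N → hasIndep S s ≡ true → (∀ e → s < e → e ≤ N → hasIndep S e ≡ false) →
                   dimFrom S N ≡ s
  dimFrom-unique S zero    zero z≤n _ _ = refl
  dimFrom-unique S (suc N) s s≤N has-s none-above with ℕₚ.m≤n⇒m<n∨m≡n s≤N
  ... | inj₂ refl rewrite has-s = refl
  ... | inj₁ s<N rewrite none-above (suc N) s<N ℕₚ.≤-refl =
    dimFrom-unique S N s (ℕₚ.≤-pred s<N) has-s (λ e s<e e≤N → none-above e s<e (ℕₚ.m≤n⇒m≤1+n e≤N))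

  members-occurs : ∀ S v → v ∈ˢ S → 1 ≤ Mᵛ.mult v (members S)
  members-occurs S v v∈ = ℕₚ.≤-reflexive (sym (trans (Mᵛ.mult-filterᵇ (λ w → member w S) vecs v)
                                                     (cong₂ (λ b m → Data.Nat._*_ (ℕSums.iverson b) m) v∈ (vecs-enumeration v))))

  members-occurs⁻ : ∀ S v → 1 ≤ Mᵛ.mult v (members S) → v ∈ˢ S
  members-occurs⁻ S v occ with member v S | subst (1 ≤_) (Mᵛ.mult-filterᵇ (λ w → member w S) vecs v) occ
  ... | true  | _  = refl
  ... | false | ()

  dim-basis : ∀ {S} → Subspace S → (B : Basis S) → dim S ≡ Basis.d B
  dim-basis {S} sub B = dimFrom-unique S n d (Independent⇒≤n vectors isIndependent) has-basis no-larger
    where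
    open Basis B
    module Mᴱ {m} = Multiplicity (Vecₚ.≡-dec {n = m} (Vecₚ.≡-dec {n = n} _≟_))
    module Pᴱ = Powers (Vecₚ.≡-dec {n = n} _≟_)
    has-basis : hasIndep S d ≡ true
    has-basis = Mᴱ.any-true independent (power (members S) d) vectors
                  (Pᴱ.power-occurs (members S) vectors (All.map (λ {v} → members-occurs S v) all∈))
                  (independent-complete vectors isIndependent)
    no-larger : ∀ e → d < e → e ≤ n → hasIndep S e ≡ false
    no-larger e d<e _ with hasIndep S e in has-e
    ... | false = refl
    ... | true with Mᴱ.any-true⁻ independent (power (members S) e) has-e
    ...   | ws , ws∈ , ws-ind = ⊥-elim (ℕₚ.<⇒≱ d<e (^-cancelʳ-≤ e d (begin
      q ^ e            ≡⟨ card-span ws (independent-sound ws ws-ind) ⟨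
      card (span ws)   ≤⟨ card-mono (span⊆ sub ws (All.map (λ {v} → members-occurs⁻ S v) (Pᴱ.power-occurs⁻ (members S) ws ws∈))) ⟩
      card S           ≡⟨ card-basis sub B ⟩
      q ^ d            ∎)))
      where open ℕₚ.≤-Reasoning

  card≡q^dim : ∀ {S} → Subspace S → card S ≡ q ^ dim S
  card≡q^dim {S} sub = trans (card-basis sub (basis S)) (cong (q ^_) (sym (dim-basis sub (basis S))))

  dim≤n : ∀ S → dim S ≤ n
  dim≤n S = dimFrom≤ n
    where
    dimFrom≤ : ∀ N → dimFrom S N ≤ N
    dimFrom≤ zero    = z≤n
    dimFrom≤ (suc N) with hasIndep S (suc N)
    ... | true  = ℕₚ.≤-refl
    ... | false = ℕₚ.m≤n⇒m≤1+n (dimFrom≤ N)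

  dim-mono : ∀ {V W} → Subspace V → Subspace W → V ⊆ˢ W → dim V ≤ dim W
  dim-mono subV subW V⊆W = ^-cancelʳ-≤ _ _ (subst₂ _≤_ (card≡q^dim subV) (card≡q^dim subW) (card-mono V⊆W))

  full-subspace : Subspace fullSpace
  full-subspace = record
    { length≡ = Listₚ.length-replicate Nₑ ; 0∈ = member-full 0ᵥ
    ; +-closed = λ u w _ _ → member-full (u +ᵥ w) ; ∙-closed = λ c u _ → member-full (c ∙ᵥ u) }

  card-full : card fullSpace ≡ q ^ n
  card-full = trans (sumMap-cong vecs (λ v → cong ℕSums.iverson (member-full v))) (trans (count-true vecs) length-vecs)

  ⊆∧card⇒≡ : ∀ {V W} → Subspace V → Subspace W → V ⊆ˢ W → card V ≡ card W → V ≡ W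
  ⊆∧card⇒≡ {V} {W} subV subW V⊆W ∣V∣≡∣W∣ = Subset-ext V W (Subspace.length≡ subV) (Subspace.length≡ subW) same-members
    where
    W∖V : E → Bool
    W∖V v = member v W ∧ not (member v V)
    W∖V-empty : count W∖V vecs ≡ 0
    W∖V-empty = ℕₚ.+-cancelˡ-≡ (card V) _ _ (trans (sym (Counting.count-split _ _ vecs V⊆W))
                                                   (trans (sym ∣V∣≡∣W∣) (sym (ℕₚ.+-identityʳ _))))
    same-members : ∀ v → member v V ≡ member v W
    same-members v with member v V in v∈V
    ... | true  = sym (V⊆W v v∈V)
    ... | false with member v W in v∈W
    ...   | false = refl
    ...   | true with () ← subst₂ _≤_ (vecs-enumeration v) W∖V-empty
                   (count-mono (v Mᵛ.=ᵇ_) W∖V vecs (λ x v=x → subst (λ z → W∖V z ≡ true) (Mᵛ.=ᵇ-sound {a = v} {b = x} v=x)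
                                                                 (∧-true v∈W (cong not v∈V))))

  record Complement (V : Subset) : Set where
    field
      r               : ℕ
      vectors         : Vec E r
      isIndependent   : Independent vectors
      decompose       : ∀ e → Σ E λ x → Σ (Vec Carrier r) λ a → x ∈ˢ V × e ≡ x +ᵥ lincomb a vectors
      independent-mod : ∀ a → lincomb a vectors ∈ˢ V → a ≡ 0ᵥ
      r+dim≡n         : r +ℕ dim V ≡ n

  -- The vectors added when extending a basis of V to a basis of E span a complement of V.
  complement : ∀ {V} → Subspace V → Complement V
  complement {V} sub = record
    { r = r ; vectors = us ; isIndependent = Independent-++ˡ us bs isIndependent
    ; decompose = decompose ; independent-mod = independent-mod ; r+dim≡n = r+dim≡n }
    where
    open Basis (basis V) using () renaming (vectors to bs; isIndependent to bs-independent; all∈ to bs∈; spans to bs-spans)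
    open Extension (extend fullSpace bs n [] (ℕₚ.m≤n+m n _) bs-independent (All.map (λ {x} _ → member-full x) bs∈))

    decompose : ∀ e → Σ E λ x → Σ (Vec Carrier r) λ a → x ∈ˢ V × e ≡ x +ᵥ lincomb a us
    decompose e with spans e (member-full e)
    ... | c , e≡ with Vec.splitAt r c
    ...   | a , b , refl =
      lincomb b bs , a , lincomb-closed sub bs bs∈ b , trans e≡ (trans (lincomb-++ a b us bs) (+ᵥ-comm _ _))

    independent-mod : ∀ a → lincomb a us ∈ˢ V → a ≡ 0ᵥ
    independent-mod a a∈ with bs-spans (lincomb a us) a∈
    ... | b , a≡b = Vecₚ.++-injectiveˡ a 0ᵥ (trans (isIndependent (a ++ (-1# ∙ᵥ b)) (begin
        lincomb (a ++ (-1# ∙ᵥ b)) (us ++ bs)      ≡⟨ lincomb-++ a (-1# ∙ᵥ b) us bs ⟩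
        lincomb a us +ᵥ lincomb (-1# ∙ᵥ b) bs     ≡⟨ cong (lincomb a us +ᵥ_) (lincomb-∙ -1# b bs) ⟩
        lincomb a us +ᵥ (-1# ∙ᵥ lincomb b bs)     ≡⟨ cong (λ z → lincomb a us +ᵥ (-1# ∙ᵥ z)) a≡b ⟨
        lincomb a us +ᵥ (-1# ∙ᵥ lincomb a us)     ≡⟨ u-u≡0 _ ⟩
        0ᵥ                                         ∎)) (0ᵥ-++ r _))
      where open ≡-Reasoning

    r+dim≡n : r +ℕ dim V ≡ n
    r+dim≡n = trans (cong (r +ℕ_) (dim-basis sub (basis V))) (^-injective _ _ (trans
      (sym (card-lincomb-image (us ++ bs) fullSpace isIndependent (λ v _ → spans v (member-full v))
                                                                  (λ c → member-full (lincomb c (us ++ bs)))))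
      card-full))

module OrthogonalComplement (𝔽 : FiniteField) (n : ℕ) (B : Space.E 𝔽 n → Space.E 𝔽 n → FiniteField.Carrier 𝔽)
                            (bil : Space.IsNondegSymBilinear 𝔽 n B) where

  open import Data.Bool using (true)
  open import Data.Nat using (_≤_; _^_) renaming (_+_ to _+ℕ_)
  import Data.Nat.Properties as ℕₚ
  open import Data.List using (map)
  import Data.List.Properties as Listₚ
  open import Data.Vec as Vec using (Vec; []; _∷_)
  import Data.Vec.Properties as Vecₚ
  open import Relation.Nullary using (does)
  open import Relation.Nullary.Decidable using (dec-true)
  open import Relation.Binary.PropositionalEquality
  open Booleans

  open FiniteField 𝔽 hiding (_+_; _*_; -_)
  open Space 𝔽 n
  open Subspaces 𝔽 n
  open CommutativeRing 𝔽-ring using (_+_; _*_; +-identityˡ; zeroˡ; zeroʳ)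
  open IsNondegSymBilinear bil

  B-0ˡ : ∀ w → B 0ᵥ w ≡ 0#
  B-0ˡ w = trans (cong (λ z → B z w) (sym (∙ᵥ-zeroˡ 0ᵥ))) (trans (homogeneous 0# 0ᵥ w) (zeroˡ _))

  B-0ʳ : ∀ v → B v 0ᵥ ≡ 0#
  B-0ʳ v = trans (symmetric v 0ᵥ) (B-0ˡ v)

  B-+ʳ : ∀ v u w → B v (u +ᵥ w) ≡ B v u + B v w
  B-+ʳ v u w = trans (symmetric v _) (trans (additive u w v) (cong₂ _+_ (symmetric u v) (symmetric w v)))

  B-∙ʳ : ∀ v c u → B v (c ∙ᵥ u) ≡ c * B v u
  B-∙ʳ v c u = trans (symmetric v _) (trans (homogeneous c u v) (cong (c *_) (symmetric u v)))

  dot : ∀ {d} → Vec Carrier d → Vec Carrier d → Carrier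
  dot []       []       = 0#
  dot (a ∷ as) (b ∷ bs) = (a * b) + dot as bs

  dot-0ʳ : ∀ {d} (a : Vec Carrier d) → dot a 0ᵥ ≡ 0#
  dot-0ʳ []      = refl
  dot-0ʳ (x ∷ a) = trans (cong₂ _+_ (zeroʳ x) (dot-0ʳ a)) (+-identityˡ 0#)

  pairings : ∀ {d} → Vec E d → E → Vec Carrier d
  pairings ws w = Vec.map (λ u → B u w) ws

  B-lincomb : ∀ {d} (a : Vec Carrier d) (ws : Vec E d) y → B (lincomb a ws) y ≡ dot a (pairings ws y)
  B-lincomb []       []       y = B-0ˡ y
  B-lincomb (a ∷ as) (w ∷ ws) y = trans (additive _ _ y) (cong₂ _+_ (homogeneous a w y) (B-lincomb as ws y))

  pairings-+ : ∀ {d} (ws : Vec E d) x y → pairings ws (x +ᵥ y) ≡ pairings ws x +ᵥ pairings ws y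
  pairings-+ []       x y = refl
  pairings-+ (u ∷ ws) x y = cong₂ _∷_ (B-+ʳ u x y) (pairings-+ ws x y)

  pairings-∙ : ∀ {d} (ws : Vec E d) c x → pairings ws (c ∙ᵥ x) ≡ c ∙ᵥ pairings ws x
  pairings-∙ []       c x = refl
  pairings-∙ (u ∷ ws) c x = cong₂ _∷_ (B-∙ʳ u c x) (pairings-∙ ws c x)

  pairings-0 : ∀ {d} (ws : Vec E d) → pairings ws 0ᵥ ≡ 0ᵥ
  pairings-0 []       = refl
  pairings-0 (u ∷ ws) = cong₂ _∷_ (B-0ʳ u) (pairings-0 ws)

  pairings-lincomb : ∀ {d k} (ws : Vec E d) (a : Vec Carrier k) (xs : Vec E k) →
                     Space.lincomb 𝔽 d a (Vec.map (pairings ws) xs) ≡ pairings ws (lincomb a xs)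
  pairings-lincomb ws []      []       = sym (pairings-0 ws)
  pairings-lincomb ws (c ∷ a) (x ∷ xs) =
    trans (cong₂ _+ᵥ_ (sym (pairings-∙ ws c x)) (pairings-lincomb ws a xs)) (sym (pairings-+ ws (c ∙ᵥ x) (lincomb a xs)))

  ∈perp : ∀ V w → (∀ v → v ∈ˢ V → B v w ≡ 0#) → w ∈ˢ perp B V
  ∈perp V w orth = trans (member-map _ w) (all-true⁺ _ vecs (λ v → ⇒ᵇ-intro (λ v∈ → is-0 (orth v v∈))))
    where
    is-0 : ∀ {a} → a ≡ 0# → does (a ≟ 0#) ≡ true
    is-0 {a} a≡0 = dec-true (a ≟ 0#) a≡0

  ∈perp⁻ : ∀ V w → w ∈ˢ perp B V → ∀ v → v ∈ˢ V → B v w ≡ 0#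
  ∈perp⁻ V w w∈ v v∈ = Mᶠ.=ᵇ-sound (⇒ᵇ-elim (Mᵛ.all-true-enum _ vecs vecs-enumeration (trans (sym (member-map _ w)) w∈) v) v∈)

  perp-subspace : ∀ V → Subspace (perp B V)
  perp-subspace V = record
    { length≡  = Listₚ.length-map _ vecs
    ; 0∈       = ∈perp V 0ᵥ (λ v _ → B-0ʳ v)
    ; +-closed = λ u w u∈ w∈ → ∈perp V (u +ᵥ w) (λ v v∈ →
        trans (B-+ʳ v u w) (trans (cong₂ _+_ (∈perp⁻ V u u∈ v v∈) (∈perp⁻ V w w∈ v v∈)) (+-identityˡ 0#)))
    ; ∙-closed = λ c u u∈ → ∈perp V (c ∙ᵥ u) (λ v v∈ →
        trans (B-∙ʳ v c u) (trans (cong (c *_) (∈perp⁻ V u u∈ v v∈)) (zeroʳ c)))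
    }

  -- On Y, y ↦ pairings cs y is injective: B(·, y) is determined by its values on cs since it
  -- vanishes on X, and B is nondegenerate.
  card-orthogonal≤ : (X Y : Subset) → (∀ x y → x ∈ˢ X → y ∈ˢ Y → B x y ≡ 0#) →
                     ∀ {c} (cs : Vec E c) → (∀ e → Σ E λ x → Σ (Vec Carrier c) λ a → x ∈ˢ X × e ≡ x +ᵥ lincomb a cs) →
                     card Y ≤ q ^ c
  card-orthogonal≤ X Y orth {c} cs decompose = ℕₚ.≤-trans
    (Image.count-injective-≤ (Vecₚ.≡-dec _≟_) (Vecₚ.≡-dec _≟_) (pairings cs) vecs (power elems c)
       (λ v → ℕₚ.≤-reflexive (vecs-enumeration v)) (Pᶠ.power-enumeration elems elems-enumeration c) (λ v → member v Y) injective)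
    (ℕₚ.≤-reflexive (Pᶠ.length-power elems c))
    where
    same-form : ∀ y y′ → y ∈ˢ Y → y′ ∈ˢ Y → pairings cs y ≡ pairings cs y′ → ∀ e → B e y ≡ B e y′
    same-form y y′ y∈ y′∈ eq e with decompose e
    ... | x , a , x∈ , refl = begin
        B (x +ᵥ lincomb a cs) y            ≡⟨ additive x _ y ⟩
        B x y + B (lincomb a cs) y         ≡⟨ cong₂ _+_ (orth x y x∈ y∈) (B-lincomb a cs y) ⟩
        0# + dot a (pairings cs y)         ≡⟨ cong (λ z → 0# + dot a z) eq ⟩
        0# + dot a (pairings cs y′)        ≡⟨ cong₂ _+_ (orth x y′ x∈ y′∈) (B-lincomb a cs y′) ⟨
        B x y′ + B (lincomb a cs) y′       ≡⟨ additive x _ y′ ⟨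
        B (x +ᵥ lincomb a cs) y′           ∎
      where open ≡-Reasoning
    injective : ∀ y y′ → y ∈ˢ Y → y′ ∈ˢ Y → pairings cs y ≡ pairings cs y′ → y ≡ y′
    injective y y′ y∈ y′∈ eq = u-v≡0⇒u≡v y y′ (nondegenerate _ (λ w → begin
        B (y +ᵥ (-1# ∙ᵥ y′)) w      ≡⟨ additive y _ w ⟩
        B y w + B (-1# ∙ᵥ y′) w     ≡⟨ cong (B y w +_) (homogeneous -1# y′ w) ⟩
        B y w + -1# * B y′ w        ≡⟨ cong₂ (λ s t → s + -1# * t) (symmetric y w) (symmetric y′ w) ⟩
        B w y + -1# * B w y′        ≡⟨ cong (λ z → B w y + -1# * z) (same-form y y′ y∈ y′∈ eq w) ⟨
        B w y + -1# * B w y         ≡⟨ x+-1*x≡0 _ ⟩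
        0#                          ∎))
      where open ≡-Reasoning

  dim-perp+dim≤n : ∀ V → Subspace V → dim (perp B V) +ℕ dim V ≤ n
  dim-perp+dim≤n V sub = subst (dim (perp B V) +ℕ dim V ≤_) r+dim≡n (ℕₚ.+-monoˡ-≤ (dim V) dim-perp≤r)
    where
    open Complement (complement sub)
    dim-perp≤r : dim (perp B V) ≤ r
    dim-perp≤r = ^-cancelʳ-≤ _ _ (subst (_≤ q ^ r) (card≡q^dim (perp-subspace V))
                   (card-orthogonal≤ V (perp B V) (λ x y x∈ y∈ → ∈perp⁻ V y y∈ x x∈) vectors decompose))

  -- The vectors of a complement of V^⊥ stay independent after pairing with a basis of V,
  -- which gives an independent family in F_q^(dim V).
  n≤dim-perp+dim : ∀ V → Subspace V → n ≤ dim (perp B V) +ℕ dim V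
  n≤dim-perp+dim V sub = subst₂ _≤_ r+dim≡n (trans (ℕₚ.+-comm d _) (cong (dim (perp B V) +ℕ_) (sym (dim-basis sub (basis V)))))
                                (ℕₚ.+-monoˡ-≤ (dim (perp B V)) (Lᵈ.Independent⇒≤n (Vec.map (pairings ws) vectors) paired-independent))
    where
    open Basis (basis V) using (d) renaming (vectors to ws; spans to ws-spans)
    open Complement (complement (perp-subspace V))
    module Lᵈ = Subspaces 𝔽 d
    pairings≡0⇒∈perp : ∀ w → pairings ws w ≡ 0ᵥ → w ∈ˢ perp B V
    pairings≡0⇒∈perp w eq = ∈perp V w orth
      where
      orth : ∀ v → v ∈ˢ V → B v w ≡ 0#
      orth v v∈ with ws-spans v v∈
      ... | c , refl = trans (B-lincomb c ws w) (trans (cong (dot c) eq) (dot-0ʳ c))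
    paired-independent : Lᵈ.Independent (Vec.map (pairings ws) vectors)
    paired-independent a eq = independent-mod a (pairings≡0⇒∈perp _ (trans (sym (pairings-lincomb ws a vectors)) eq))

  dim-perp+dim : ∀ V → Subspace V → dim (perp B V) +ℕ dim V ≡ n
  dim-perp+dim V sub = ℕₚ.≤-antisym (dim-perp+dim≤n V sub) (n≤dim-perp+dim V sub)

module QMatroid (𝔽 : FiniteField) (n : ℕ) (ρ : Space.Subset 𝔽 n → ℕ) (qm : Space.IsQMatroid 𝔽 n ρ) where

  open import Data.Bool using (true)
  open import Data.Bool.Properties using (T-≡)
  open import Data.Nat using (_≤_) renaming (_+_ to _+ℕ_)
  import Data.Nat.Properties as ℕₚ
  import Data.List.Properties as Listₚ
  open import Function using (Equivalence)
  open import Relation.Binary.PropositionalEquality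
  open Booleans

  open Space 𝔽 n
  open Subspaces 𝔽 n
  open IsQMatroid qm

  k : ℕ
  k = ρ fullSpace

  Subspace⇒IsSubspace : ∀ {V} → Subspace V → IsSubspace V
  Subspace⇒IsSubspace sub = Equivalence.from T-≡ (Subspace⇒isSubspaceᵇ sub)

  ρ≤dim : ∀ V → Subspace V → ρ V ≤ dim V
  ρ≤dim V sub = bounded V (Subspace⇒IsSubspace sub)

  ρ≤k : ∀ V → Subspace V → ρ V ≤ k
  ρ≤k V sub = monotone V fullSpace (Subspace⇒IsSubspace sub) (Subspace⇒IsSubspace full-subspace)
                       (Equivalence.from T-≡ (⊆ᵇ-complete (λ v _ → member-full v)))

  ⊕-complement : ∀ {V} (C : Complement V) → V ⊕ span (Complement.vectors C) ≡ fullSpace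
  ⊕-complement {V} C = Subset-ext _ fullSpace (Listₚ.length-map _ vecs) (Listₚ.length-replicate Nₑ) everything
    where
    open Complement C
    everything : ∀ e → member e (V ⊕ span vectors) ≡ member e fullSpace
    everything e with decompose e
    ... | x , a , x∈ , e≡ = trans (member-map _ e) (trans
          (Mᵛ.any-true-enum _ vecs vecs-enumeration x (∧-true x∈
            (Mᵛ.any-true-enum _ vecs vecs-enumeration (lincomb a vectors)
              (∧-true (lincomb∈span vectors a) (subst (λ z → (e == z) ≡ true) e≡ (Mᵛ.=ᵇ-refl e))))))
          (sym (member-full e)))

  -- Submodularity against a complement W of V: k = ρ(V ⊕ W) ≤ ρ V + ρ W ≤ ρ V + (n - dim V).
  dim+k≤n+ρ : ∀ V → Subspace V → dim V +ℕ k ≤ n +ℕ ρ V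
  dim+k≤n+ρ V sub = begin
      dim V +ℕ k                              ≡⟨ cong (λ z → dim V +ℕ ρ z) (⊕-complement C) ⟨
      dim V +ℕ ρ (V ⊕ W)                      ≤⟨ ℕₚ.+-monoʳ-≤ (dim V) (ℕₚ.m≤m+n (ρ (V ⊕ W)) (ρ (V ∩ W))) ⟩
      dim V +ℕ (ρ (V ⊕ W) +ℕ ρ (V ∩ W))       ≤⟨ ℕₚ.+-monoʳ-≤ (dim V) (submodular V W (Subspace⇒IsSubspace sub) (Subspace⇒IsSubspace subW)) ⟩
      dim V +ℕ (ρ V +ℕ ρ W)                   ≤⟨ ℕₚ.+-monoʳ-≤ (dim V) (ℕₚ.+-monoʳ-≤ (ρ V) (ρ≤dim W subW)) ⟩
      dim V +ℕ (ρ V +ℕ dim W)                 ≡⟨ cong (λ z → dim V +ℕ (ρ V +ℕ z)) dim-W ⟩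
      dim V +ℕ (ρ V +ℕ r)                     ≡⟨ rearrange (dim V) (ρ V) r ⟩
      (r +ℕ dim V) +ℕ ρ V                     ≡⟨ cong (_+ℕ ρ V) r+dim≡n ⟩
      n +ℕ ρ V                                ∎
    where
    open ℕₚ.≤-Reasoning
    C : Complement V
    C = complement sub
    open Complement C using (r; vectors; isIndependent; r+dim≡n)
    W : Subset
    W = span vectors
    subW : Subspace W
    subW = span-subspace vectors
    dim-W : dim W ≡ r
    dim-W = ^-injective _ _ (trans (sym (card≡q^dim subW)) (card-span vectors isIndependent))
    rearrange : ∀ a b c → a +ℕ (b +ℕ c) ≡ (c +ℕ a) +ℕ b
    rearrange a b c = trans (cong (a +ℕ_) (ℕₚ.+-comm b c)) (trans (sym (ℕₚ.+-assoc a c b)) (cong (_+ℕ b) (ℕₚ.+-comm a c)))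

module SubspaceLattice (𝔽 : FiniteField) (n : ℕ) where

  open import Data.Bool using (Bool; true; false)
  import Data.Bool.Properties as Boolₚ
  open import Data.Nat using (zero; suc; _≡ᵇ_; _*_) renaming (_+_ to _+ℕ_)
  import Data.Nat.Properties as ℕₚ
  open import Data.List using (List; []; _∷_; map; length; filterᵇ)
  import Data.List.Properties as Listₚ
  open import Relation.Binary.PropositionalEquality
  open ℕSums
  open Counting
  open Booleans

  open Space 𝔽 n
  open Subspaces 𝔽 n
  module Mˢ = Multiplicity (Listₚ.≡-dec Boolₚ._≟_)

  mult-allSubsets : ∀ N S → Mˢ.mult S (allSubsets N) ≡ iverson (length S ≡ᵇ N)
  mult-allSubsets zero    []      = refl
  mult-allSubsets zero    (b ∷ S) = refl
  mult-allSubsets (suc N) S = begin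
      Mˢ.mult S (allSubsets (suc N))
    ≡⟨ sumMap-concatMap (λ S′ → iverson (S Mˢ.=ᵇ S′)) (λ b → map (b ∷_) (allSubsets N)) (true ∷ false ∷ []) ⟩
      Mˢ.mult S (map (true ∷_) (allSubsets N)) +ℕ (Mˢ.mult S (map (false ∷_) (allSubsets N)) +ℕ 0)
    ≡⟨ cong₂ (λ a b → a +ℕ (b +ℕ 0)) (sumMap-map _ (true ∷_) (allSubsets N)) (sumMap-map _ (false ∷_) (allSubsets N)) ⟩
      count (λ S′ → S Mˢ.=ᵇ (true ∷ S′)) (allSubsets N) +ℕ (count (λ S′ → S Mˢ.=ᵇ (false ∷ S′)) (allSubsets N) +ℕ 0)
    ≡⟨ by-head S ⟩
      iverson (length S ≡ᵇ suc N) ∎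
    where
    open ≡-Reasoning
    by-head : ∀ S → count (λ S′ → S Mˢ.=ᵇ (true ∷ S′)) (allSubsets N) +ℕ (count (λ S′ → S Mˢ.=ᵇ (false ∷ S′)) (allSubsets N) +ℕ 0)
                    ≡ iverson (length S ≡ᵇ suc N)
    by-head []          rewrite count-0 (λ S′ → [] Mˢ.=ᵇ (true ∷ S′)) (allSubsets N) (λ _ → refl) = refl
    by-head (true ∷ S)  rewrite count-0 (λ S′ → (true ∷ S) Mˢ.=ᵇ (false ∷ S′)) (allSubsets N) (λ _ → refl) =
      trans (ℕₚ.+-identityʳ _) (mult-allSubsets N S)
    by-head (false ∷ S) rewrite count-0 (λ S′ → (false ∷ S) Mˢ.=ᵇ (true ∷ S′)) (allSubsets N) (λ _ → refl) =
      trans (ℕₚ.+-identityʳ _) (mult-allSubsets N S)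

  mult-L : ∀ {S} → Subspace S → Mˢ.mult S L ≡ 1
  mult-L {S} sub = begin
      Mˢ.mult S (filterᵇ isSubspaceᵇ (allSubsets Nₑ))
    ≡⟨ Mˢ.mult-filterᵇ isSubspaceᵇ (allSubsets Nₑ) S ⟩
      iverson (isSubspaceᵇ S) * Mˢ.mult S (allSubsets Nₑ)
    ≡⟨ cong₂ (λ b m → iverson b * m) (Subspace⇒isSubspaceᵇ sub) (mult-allSubsets Nₑ S) ⟩
      iverson (length S ≡ᵇ Nₑ) +ℕ 0
    ≡⟨ cong (λ b → iverson b +ℕ 0) (≡ᵇ-complete (Subspace.length≡ sub)) ⟩
      1 ∎
    where open ≡-Reasoning

  sumMap-L-cong : {f g : Subset → ℕ} → (∀ W → Subspace W → f W ≡ g W) → sumMap f L ≡ sumMap g L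
  sumMap-L-cong f≡g = sumMap-cong-filterᵇ isSubspaceᵇ (allSubsets Nₑ) (λ W e → f≡g W (isSubspaceᵇ⇒Subspace e))

module Superspaces (𝔽 : FiniteField) (n : ℕ) where

  open import Data.Bool using (Bool; true; false; _∧_; not)
  import Data.Bool.Properties as Boolₚ
  open import Data.Nat using (zero; suc; _≤_; _≡ᵇ_; _^_; _∸_; _*_) renaming (_+_ to _+ℕ_)
  import Data.Nat.Properties as ℕₚ
  open import Data.Vec using (Vec; _∷_)
  open import Data.Vec.Relation.Unary.All as All using (All; _∷_)
  open import Relation.Binary.PropositionalEquality
  open ℕSums
  open Counting
  open Booleans

  open FiniteField 𝔽 using (1#; 0#; q)
  open Space 𝔽 n
  open Subspaces 𝔽 n
  open SubspaceLattice 𝔽 n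
  open GaussianBinomial q 1<q using (frames; gauss-unique)

  -- extensions ws U r counts the r-tuples of vectors of U that extend ws to an independent family.
  extensions : ∀ {s} → Vec E s → Subset → ℕ → ℕ
  extensions ws U zero    = 1
  extensions ws U (suc r) = sumMap (λ u → iverson (member u U ∧ not (spanᵇ ws u)) * extensions (u ∷ ws) U r) vecs

  extensions≡frames : ∀ r t {s} (ws : Vec E s) U → Subspace U → Independent ws → All (_∈ˢ U) ws →
                      card U ≡ q ^ t → extensions ws U r ≡ frames t s r
  extensions≡frames zero    t     ws U subU ind ws∈ ∣U∣ = refl
  extensions≡frames (suc r) t {s} ws U subU ind ws∈ ∣U∣ = begin
      sumMap (λ u → iverson (fresh u) * extensions (u ∷ ws) U r) vecs
    ≡⟨ sumMap-cong vecs (λ u → iverson-*-cong (fresh u) (extend-by u)) ⟩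
      sumMap (λ u → iverson (fresh u) * frames t (suc s) r) vecs
    ≡⟨ *-distribʳ-sumMap (frames t (suc s) r) _ vecs ⟨
      count fresh vecs * frames t (suc s) r
    ≡⟨ cong (_* frames t (suc s) r) count-fresh ⟩
      (q ^ t ∸ q ^ s) * frames t (suc s) r ∎
    where
    open ≡-Reasoning
    fresh : E → Bool
    fresh u = member u U ∧ not (spanᵇ ws u)
    extend-by : ∀ u → fresh u ≡ true → extensions (u ∷ ws) U r ≡ frames t (suc s) r
    extend-by u fresh-u with member u U in u∈ | spanᵇ ws u in u∉
    ... | true | false = extensions≡frames r t (u ∷ ws) U subU (Independent-∷ u ws ind (spanᵇ-false ws u u∉)) (u∈ ∷ ws∈) ∣U∣
    span∈U : ∀ v → spanᵇ ws v ≡ true → member v U ≡ true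
    span∈U v v∈ = span⊆ subU ws ws∈ v (trans (member-map (spanᵇ ws) v) v∈)
    count-fresh : count fresh vecs ≡ q ^ t ∸ q ^ s
    count-fresh = begin
        count fresh vecs                                              ≡⟨ ℕₚ.m+n∸m≡n (count (spanᵇ ws) vecs) _ ⟨
        count (spanᵇ ws) vecs +ℕ count fresh vecs ∸ count (spanᵇ ws) vecs ≡⟨ cong₂ _∸_ (sym (count-split _ _ vecs span∈U)) ∣span∣ ⟩
        card U ∸ q ^ s                                                ≡⟨ cong (_∸ q ^ s) ∣U∣ ⟩
        q ^ t ∸ q ^ s                                                 ∎
      where
      ∣span∣ : count (spanᵇ ws) vecs ≡ q ^ s
      ∣span∣ = trans (sumMap-cong vecs (λ v → cong iverson (sym (member-map (spanᵇ ws) v)))) (card-span ws ind)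

  span-∷-⊆ᵇ : ∀ {s} (ws : Vec E s) u W → Subspace W → (span (u ∷ ws) ⊆ᵇ W) ≡ (member u W ∧ (span ws ⊆ᵇ W))
  span-∷-⊆ᵇ ws u W subW = true-ext to from
    where
    to : (span (u ∷ ws) ⊆ᵇ W) ≡ true → (member u W ∧ (span ws ⊆ᵇ W)) ≡ true
    to u∷ws⊆W = ∧-true (⊆ᵇ-sound u∷ws⊆W u (subst (_∈ˢ span (u ∷ ws)) (lincomb-1∷0 u ws) (lincomb∈span (u ∷ ws) (1# ∷ 0ᵥ))))
                       (⊆ᵇ-complete ws⊆W)
      where
      ws⊆W : span ws ⊆ˢ W
      ws⊆W v v∈ with span⇒lincomb ws v v∈
      ... | c , refl = ⊆ᵇ-sound u∷ws⊆W (lincomb c ws) (subst (_∈ˢ span (u ∷ ws)) (lincomb-0∷ u ws c) (lincomb∈span (u ∷ ws) (0# ∷ c)))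
    from : (member u W ∧ (span ws ⊆ᵇ W)) ≡ true → (span (u ∷ ws) ⊆ᵇ W) ≡ true
    from u∈∧ws⊆W = ⊆ᵇ-complete u∷ws⊆W
      where
      u∷ws⊆W : span (u ∷ ws) ⊆ˢ W
      u∷ws⊆W v v∈ with span⇒lincomb (u ∷ ws) v v∈
      ... | a ∷ c , refl = Subspace.+-closed subW (a ∙ᵥ u) (lincomb c ws) (Subspace.∙-closed subW a u (∧-trueˡ u∈∧ws⊆W))
                             (⊆ᵇ-sound (∧-trueʳ {member u W} u∈∧ws⊆W) (lincomb c ws) (lincomb∈span ws c))

  -- An independent extension of ws by r vectors spans exactly one subspace of size q^(s+r)
  -- containing span ws, so the extensions inside E are partitioned by these subspaces.
  extensions-full : ∀ r {s} (ws : Vec E s) → Independent ws →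
                    extensions ws fullSpace r
                      ≡ sumMap (λ W → iverson ((span ws ⊆ᵇ W) ∧ (card W ≡ᵇ q ^ (s +ℕ r))) * extensions ws W r) L
  extensions-full zero {s} ws ind = sym (begin
      sumMap (λ W → iverson ((span ws ⊆ᵇ W) ∧ (card W ≡ᵇ q ^ (s +ℕ 0))) * 1) L
    ≡⟨ sumMap-L-cong (λ W subW → cong (λ b → iverson b * 1) (spanned-by W subW)) ⟩
      sumMap (λ W → iverson (span ws Mˢ.=ᵇ W) * 1) L
    ≡⟨ sumMap-cong L (λ W → ℕₚ.*-identityʳ _) ⟩
      Mˢ.mult (span ws) L
    ≡⟨ mult-L (span-subspace ws) ⟩
      1 ∎)
    where
    open ≡-Reasoning
    ∣span∣ : card (span ws) ≡ q ^ (s +ℕ 0)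
    ∣span∣ = trans (card-span ws ind) (cong (q ^_) (sym (ℕₚ.+-identityʳ s)))
    spanned-by : ∀ W → Subspace W → ((span ws ⊆ᵇ W) ∧ (card W ≡ᵇ q ^ (s +ℕ 0))) ≡ (span ws Mˢ.=ᵇ W)
    spanned-by W subW = true-ext
      (λ h → subst (λ Z → (span ws Mˢ.=ᵇ Z) ≡ true)
               (⊆∧card⇒≡ (span-subspace ws) subW (⊆ᵇ-sound (∧-trueˡ h)) (trans ∣span∣ (sym (≡ᵇ-sound (∧-trueʳ {span ws ⊆ᵇ W} h)))))
               (Mˢ.=ᵇ-refl (span ws)))
      (λ h → subst (λ Z → ((span ws ⊆ᵇ Z) ∧ (card Z ≡ᵇ q ^ (s +ℕ 0))) ≡ true) (Mˢ.=ᵇ-sound h)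
               (∧-true (⊆ᵇ-complete (λ v v∈ → v∈)) (≡ᵇ-complete ∣span∣)))
  extensions-full (suc r) {s} ws ind = begin
      sumMap (λ u → iverson (member u fullSpace ∧ not (spanᵇ ws u)) * extensions (u ∷ ws) fullSpace r) vecs
    ≡⟨ sumMap-cong vecs split-by-subspace ⟩
      sumMap (λ u → sumMap (F u) L) vecs
    ≡⟨ sumMap-swap F vecs L ⟩
      sumMap (λ W → sumMap (λ u → F u W) vecs) L
    ≡⟨ sumMap-cong L (λ W → trans (sumMap-cong vecs (λ u → reorder (C W) (member u W) (not (spanᵇ ws u)) _))
                                   (sym (*-distribˡ-sumMap (iverson (C W)) _ vecs))) ⟩
      sumMap (λ W → iverson (C W) * extensions ws W (suc r)) L
    ≡⟨ cong (λ e → sumMap (λ W → iverson ((span ws ⊆ᵇ W) ∧ (card W ≡ᵇ q ^ e)) * extensions ws W (suc r)) L)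
            (sym (ℕₚ.+-suc s r)) ⟩
      sumMap (λ W → iverson ((span ws ⊆ᵇ W) ∧ (card W ≡ᵇ q ^ (s +ℕ suc r))) * extensions ws W (suc r)) L ∎
    where
    open ≡-Reasoning
    C : Subset → Bool
    C W = (span ws ⊆ᵇ W) ∧ (card W ≡ᵇ q ^ (suc s +ℕ r))
    F : E → Subset → ℕ
    F u W = iverson (not (spanᵇ ws u)) * (iverson (member u W ∧ C W) * extensions (u ∷ ws) W r)
    split-by-subspace : ∀ u → iverson (member u fullSpace ∧ not (spanᵇ ws u)) * extensions (u ∷ ws) fullSpace r
                              ≡ sumMap (λ W → iverson (not (spanᵇ ws u)) * (iverson (member u W ∧ C W) * extensions (u ∷ ws) W r)) L
    split-by-subspace u rewrite member-full u with spanᵇ ws u in u∉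
    ... | true  = sym (sumMap-0 L (λ _ → refl))
    ... | false = trans (ℕₚ.+-identityʳ _) (trans (extensions-full r (u ∷ ws) (Independent-∷ u ws ind (spanᵇ-false ws u u∉)))
                                                   (sumMap-L-cong same-condition))
      where
      same-condition : ∀ W → Subspace W →
        iverson ((span (u ∷ ws) ⊆ᵇ W) ∧ (card W ≡ᵇ q ^ (suc s +ℕ r))) * extensions (u ∷ ws) W r
          ≡ 1 * (iverson (member u W ∧ C W) * extensions (u ∷ ws) W r)
      same-condition W subW rewrite span-∷-⊆ᵇ ws u W subW
                                  | Boolₚ.∧-assoc (member u W) (span ws ⊆ᵇ W) (card W ≡ᵇ q ^ (suc s +ℕ r)) =
        sym (ℕₚ.+-identityʳ _)
    reorder : ∀ c m f X → iverson f * (iverson (m ∧ c) * X) ≡ iverson c * (iverson (m ∧ f) * X)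
    reorder c true  f X = x∙yz≈y∙xz (iverson f) (iverson c) X
      where open import Algebra.Properties.CommutativeSemigroup ℕₚ.*-commutativeSemigroup using (x∙yz≈y∙xz)
    reorder c false f X = trans (ℕₚ.*-zeroʳ (iverson f)) (sym (ℕₚ.*-zeroʳ (iverson c)))

  count-superspaces : ∀ {V} → Subspace V → ∀ r →
                      count (λ W → (V ⊆ᵇ W) ∧ (dim W ≡ᵇ dim V +ℕ r)) L ≡ gauss q (n ∸ dim V) r
  count-superspaces {V} subV r rewrite dim-basis subV (basis V) =
    gauss-unique d (n ∸ d) r _ (begin
      count C′ L * frames (d +ℕ r) d r                              ≡⟨ *-distribʳ-sumMap _ _ L ⟩
      sumMap (λ W → iverson (C′ W) * frames (d +ℕ r) d r) L         ≡⟨ sumMap-L-cong per-subspace ⟨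
      sumMap (λ W → iverson (C W) * extensions ws W r) L            ≡⟨ extensions-full r ws isIndependent ⟨
      extensions ws fullSpace r                                     ≡⟨ extensions≡frames r n ws fullSpace full-subspace isIndependent
                                                                         (All.map (λ {v} _ → member-full v) all∈) card-full ⟩
      frames n d r                                                  ≡⟨ cong (λ t → frames t d r) (ℕₚ.m+[n∸m]≡n d≤n) ⟨
      frames (d +ℕ (n ∸ d)) d r                                     ∎)
    where
    open ≡-Reasoning
    open Basis (basis V) renaming (vectors to ws)
    d≤n : d ≤ n
    d≤n = Independent⇒≤n ws isIndependent
    span≡V : span ws ≡ V
    span≡V = ⊆∧card⇒≡ (span-subspace ws) subV (span⊆ subV ws all∈)
                       (trans (card-span ws isIndependent) (sym (card-basis subV (basis V))))
    C C′ : Subset → Bool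
    C W = (span ws ⊆ᵇ W) ∧ (card W ≡ᵇ q ^ (d +ℕ r))
    C′ W = (V ⊆ᵇ W) ∧ (dim W ≡ᵇ d +ℕ r)
    C≡C′ : ∀ W → Subspace W → C W ≡ C′ W
    C≡C′ W subW rewrite span≡V = cong ((V ⊆ᵇ W) ∧_) (true-ext
      (λ h → ≡ᵇ-complete (^-injective (dim W) (d +ℕ r) (trans (sym (card≡q^dim subW)) (≡ᵇ-sound {card W} h))))
      (λ h → ≡ᵇ-complete (trans (card≡q^dim subW) (cong (q ^_) (≡ᵇ-sound {dim W} h)))))
    per-subspace : ∀ W → Subspace W → iverson (C W) * extensions ws W r ≡ iverson (C′ W) * frames (d +ℕ r) d r
    per-subspace W subW = trans (iverson-*-cong (C W) frames-in-W) (cong (λ b → iverson b * frames (d +ℕ r) d r) (C≡C′ W subW))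
      where
      frames-in-W : C W ≡ true → extensions ws W r ≡ frames (d +ℕ r) d r
      frames-in-W CW = extensions≡frames r (d +ℕ r) ws W subW isIndependent
                         (All.map (λ {v} v∈ → ⊆ᵇ-sound (∧-trueˡ CW) v (subst (v ∈ˢ_) (sym span≡V) v∈)) all∈)
                         (≡ᵇ-sound (∧-trueʳ {span ws ⊆ᵇ W} CW))

module IndexArithmetic where

  open import Data.Bool using (true; _∧_)
  open import Data.Nat using (_+_; _∸_; _≤_; _≡ᵇ_; _≤ᵇ_)
  open import Data.Nat.Properties
  open import Relation.Binary.PropositionalEquality
  open import Data.Nat.Solver using (module +-*-Solver)
  open +-*-Solver
  open Booleans

  private
    regroup : ∀ p e j → (p + e) + (p + j) ≡ (p + (e + j)) + p
    regroup = solve 3 (λ p e j → (p :+ e) :+ (p :+ j) := (p :+ (e :+ j)) :+ p) refl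

    n∸d : ∀ p e j g → p + (e + j) + g ∸ (p + e) ≡ j + g
    n∸d p e j g = trans (cong (_∸ (p + e)) (solve 4 (λ p e j g → p :+ (e :+ j) :+ g := (p :+ e) :+ (j :+ g)) refl p e j g))
                        (m+n∸m≡n (p + e) (j + g))

    n∸k : ∀ p e j g → p + (e + j) + g ∸ (p + j) ≡ e + g
    n∸k p e j g = trans (cong (_∸ (p + j)) (solve 4 (λ p e j g → p :+ (e :+ j) :+ g := (p :+ j) :+ (e :+ g)) refl p e j g))
                        (m+n∸m≡n (p + j) (e + g))

  -- A subspace of rank p and dimension d is counted by N_{r, n-k+r-a} exactly when a = n - d and
  -- r = k - p.  Writing d = p + e, k = p + j and n = p + (e + j) + g, which the q-matroid
  -- inequalities allow, makes all truncated subtractions below exact.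
  N-index : ∀ n k d p a r → p ≤ d → p ≤ k → d + k ≤ n + p → r ≤ k →
            ((a ≤ᵇ (n ∸ k) + r) ∧ ((n ∸ k) + r ∸ a ≤ᵇ n ∸ k)) ∧ ((p ≡ᵇ k ∸ r) ∧ (d ≡ᵇ (k ∸ r) + ((n ∸ k) + r ∸ a)))
              ≡ (n ∸ d ≡ᵇ a) ∧ (k ∸ p ≡ᵇ r)
  N-index n k d p a r p≤d p≤k d+k≤n+p r≤k
    with e , refl ← m≤n⇒∃[o]m+o≡n p≤d | j , refl ← m≤n⇒∃[o]m+o≡n p≤k
    with g , refl ← m≤n⇒∃[o]m+o≡n (+-cancelʳ-≤ p (p + (e + j)) n (subst (_≤ n + p) (regroup p e j) d+k≤n+p))
    rewrite n∸d p e j g | m+n∸m≡n p j | n∸k p e j g = true-ext to from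
    where
    e+g+j∸[j+g]≡e : e + g + j ∸ (j + g) ≡ e
    e+g+j∸[j+g]≡e = trans (cong (_∸ (j + g)) (solve 3 (λ e g j → e :+ g :+ j := e :+ (j :+ g)) refl e g j)) (m+n∸n≡m e (j + g))

    to : ((a ≤ᵇ (e + g) + r) ∧ ((e + g) + r ∸ a ≤ᵇ e + g)) ∧ ((p ≡ᵇ p + j ∸ r) ∧ (p + e ≡ᵇ (p + j ∸ r) + ((e + g) + r ∸ a)))
           ≡ true → ((j + g ≡ᵇ a) ∧ (j ≡ᵇ r)) ≡ true
    to h = ∧-true (≡ᵇ-complete (sym a≡j+g)) (≡ᵇ-complete (sym r≡j))
      where
      a≤ : a ≤ (e + g) + r
      a≤ = ≤ᵇ-sound (∧-trueˡ (∧-trueˡ h))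
      p≡ : p ≡ p + j ∸ r
      p≡ = ≡ᵇ-sound (∧-trueˡ (∧-trueʳ {(a ≤ᵇ (e + g) + r) ∧ ((e + g) + r ∸ a ≤ᵇ e + g)} h))
      p+e≡ : p + e ≡ (p + j ∸ r) + ((e + g) + r ∸ a)
      p+e≡ = ≡ᵇ-sound (∧-trueʳ {p ≡ᵇ p + j ∸ r} (∧-trueʳ {(a ≤ᵇ (e + g) + r) ∧ ((e + g) + r ∸ a ≤ᵇ e + g)} h))
      r≡j : r ≡ j
      r≡j = +-cancelˡ-≡ p r j (trans (cong (_+ r) p≡) (m∸n+n≡m r≤k))
      e≡ : e ≡ (e + g) + r ∸ a
      e≡ = +-cancelˡ-≡ p _ _ (trans p+e≡ (cong (_+ ((e + g) + r ∸ a)) (sym p≡)))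
      a≡j+g : a ≡ j + g
      a≡j+g = +-cancelˡ-≡ e a (j + g) (begin
        e + a                     ≡⟨ +-comm e a ⟩
        a + e                     ≡⟨ cong (a +_) e≡ ⟩
        a + ((e + g) + r ∸ a)     ≡⟨ m+[n∸m]≡n a≤ ⟩
        (e + g) + r               ≡⟨ cong (e + g +_) r≡j ⟩
        (e + g) + j               ≡⟨ solve 3 (λ e g j → e :+ g :+ j := e :+ (j :+ g)) refl e g j ⟩
        e + (j + g)               ∎)
        where open ≡-Reasoning

    from : ((j + g ≡ᵇ a) ∧ (j ≡ᵇ r)) ≡ true →
           ((a ≤ᵇ (e + g) + r) ∧ ((e + g) + r ∸ a ≤ᵇ e + g)) ∧ ((p ≡ᵇ p + j ∸ r) ∧ (p + e ≡ᵇ (p + j ∸ r) + ((e + g) + r ∸ a)))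
             ≡ true
    from h with ≡ᵇ-sound {j + g} (∧-trueˡ h) | ≡ᵇ-sound {j} (∧-trueʳ {j + g ≡ᵇ a} h)
    ... | refl | refl = ∧-true (∧-true (≤ᵇ-complete a≤) (≤ᵇ-complete (subst (_≤ e + g) (sym e+g+j∸[j+g]≡e) (m≤m+n e g))))
                               (∧-true (≡ᵇ-complete (sym (m+n∸n≡m p j)))
                                       (≡ᵇ-complete (cong₂ _+_ (sym (m+n∸n≡m p j)) (sym e+g+j∸[j+g]≡e))))
      where
      a≤ : j + g ≤ e + g + j
      a≤ = subst (_≤ e + g + j) (+-comm g j) (subst (g + j ≤_) (sym (+-assoc e g j)) (m≤n+m (g + j) e))

module Proposition (𝔽 : FiniteField) (n : ℕ) (B : Space.E 𝔽 n → Space.E 𝔽 n → FiniteField.Carrier 𝔽)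
                   (bil : Space.IsNondegSymBilinear 𝔽 n B) (ρ : Space.Subset 𝔽 n → ℕ) (qm : Space.IsQMatroid 𝔽 n ρ) where

  open import Data.Bool using (Bool; true; false; _∧_; if_then_else_)
  import Data.Bool.Properties as Boolₚ
  open import Data.Nat using (zero; suc; _≤_; _≡ᵇ_; _≤ᵇ_; _^_; _∸_; s≤s) renaming (_+_ to _+ℕ_)
  import Data.Nat.Properties as ℕₚ
  open import Data.Integer as ℤ using (ℤ; +_)
  import Data.Integer.Properties as ℤₚ
  open import Data.Fin using (Fin; toℕ)
  open import Data.Nat.Combinatorics using (_C_)
  import Data.Fin.Properties as Finₚ
  open import Data.List using (List; length; filterᵇ; allFin; lookup)
  import Data.List.Properties as Listₚ
  open import Data.List.Membership.Propositional.Properties using (∈-lookup)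
  import Data.List.Relation.Unary.All as All
  open import Data.List.Relation.Unary.All.Properties using (all-filter)
  open import Data.Bool.Properties using (T-≡; T?)
  open import Function using (Equivalence)
  open import Relation.Binary.PropositionalEquality
  open Booleans

  open FiniteField 𝔽 using (q)
  open Space 𝔽 n
  open Matrices B ρ
  open Subspaces 𝔽 n
  open OrthogonalComplement 𝔽 n B bil using (perp-subspace; dim-perp+dim)
  open QMatroid 𝔽 n ρ qm using (ρ≤dim; ρ≤k; dim+k≤n+ρ)
  open SubspaceLattice 𝔽 n using (module Mˢ; mult-L; sumMap-L-cong)
  open Superspaces 𝔽 n using (count-superspaces)
  module ℤΣ = Sums ℤₚ.+-*-commutativeSemiring

  sub-subspace : ∀ l → Subspace (sub l)
  sub-subspace l = isSubspaceᵇ⇒Subspace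
    (Equivalence.to T-≡ (All.lookup (all-filter (λ S → T? (isSubspaceᵇ S)) (allSubsets Nₑ)) (∈-lookup l)))

  -- The subspaces counted by the entry N_{r, n-k+r-a}.
  contributes : ℕ → ℕ → Subset → Bool
  contributes a r V = (n ∸ dim V ≡ᵇ a) ∧ (k ∸ ρ V ≡ᵇ r)

  N-entry : ∀ i j → Nmat i j ≡ + length (filterᵇ (contributes (toℕ j) (toℕ i)) L)
  N-entry i j = guarded (toℕ j) (toℕ i) (ℕₚ.≤-pred (Finₚ.toℕ<n i))
    where
    guarded : ∀ a r → r ≤ k →
              (if (a ≤ᵇ (n ∸ k) +ℕ r) ∧ (((n ∸ k) +ℕ r ∸ a) ≤ᵇ (n ∸ k)) then + ν r ((n ∸ k) +ℕ r ∸ a) else + 0)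
                ≡ + length (filterᵇ (contributes a r) L)
    guarded a r r≤k = by-range _ refl
      where
      in-range : Bool
      in-range = (a ≤ᵇ (n ∸ k) +ℕ r) ∧ (((n ∸ k) +ℕ r ∸ a) ≤ᵇ (n ∸ k))
      rank-dim : Subset → Bool
      rank-dim V = (ρ V ≡ᵇ (k ∸ r)) ∧ (dim V ≡ᵇ ((k ∸ r) +ℕ ((n ∸ k) +ℕ r ∸ a)))
      selects : ∀ b → in-range ≡ b → ∀ V → Subspace V → (b ∧ rank-dim V) ≡ contributes a r V
      selects b refl V subV =
        IndexArithmetic.N-index n k (dim V) (ρ V) a r (ρ≤dim V subV) (ρ≤k V subV) (dim+k≤n+ρ V subV) r≤k
      by-range : ∀ b → in-range ≡ b → (if b then + ν r ((n ∸ k) +ℕ r ∸ a) else + 0) ≡ + length (filterᵇ (contributes a r) L)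
      by-range true  e = cong +_ (begin
          length (filterᵇ rank-dim L)                             ≡⟨ ℕSums.length-filterᵇ rank-dim L ⟩
          ℕSums.count rank-dim L                                  ≡⟨ sumMap-L-cong (λ V subV → cong ℕSums.iverson (selects true e V subV)) ⟩
          ℕSums.count (contributes a r) L                         ≡⟨ ℕSums.length-filterᵇ (contributes a r) L ⟨
          length (filterᵇ (contributes a r) L)                    ∎)
        where open ≡-Reasoning
      by-range false e = cong +_ (sym (begin
          length (filterᵇ (contributes a r) L)                    ≡⟨ ℕSums.length-filterᵇ (contributes a r) L ⟩
          ℕSums.count (contributes a r) L                         ≡⟨ sumMap-L-cong (λ V subV → cong ℕSums.iverson (sym (selects false e V subV))) ⟩
          ℕSums.count (λ _ → false) L                             ≡⟨ Counting.count-0 (λ _ → false) L (λ _ → refl) ⟩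
          0                                                       ∎))
        where open ≡-Reasoning

  +length-filterᵇ : ∀ p → + length (filterᵇ p L) ≡ ℤΣ.count p L
  +length-filterᵇ p = ℤΣ.fromℕ-length-filterᵇ +_ refl (λ _ → refl) p L

  dim-perp : ∀ V → Subspace V → dim (perp B V) ≡ n ∸ dim V
  dim-perp V subV = trans (sym (ℕₚ.m+n∸n≡m _ (dim V))) (cong (_∸ dim V) (dim-perp+dim V subV))

  DPK≡Nᵀ : ∀ i j → ((Dmat · Pmat) · Kmat) i j ≡ (Nmat ᵀ) i j
  DPK≡Nᵀ i j = begin
      ((Dmat · Pmat) · Kmat) i j                     ≡⟨ ℤΣ.sumMap-allFin-lookup entry L ⟩
      ℤΣ.sumMap entry L                              ≡⟨ ℤΣ.sumMap-cong-filterᵇ isSubspaceᵇ (allSubsets Nₑ)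
                                                         (λ V e → entry≡ V (isSubspaceᵇ⇒Subspace e)) ⟩
      ℤΣ.count (contributes a r) L                   ≡⟨ +length-filterᵇ (contributes a r) ⟨
      + length (filterᵇ (contributes a r) L)         ≡⟨ N-entry j i ⟨
      (Nmat ᵀ) i j                                   ∎
    where
    open ≡-Reasoning
    a r : ℕ
    a = toℕ i
    r = toℕ j
    entry : Subset → ℤ
    entry V = ℤΣ.sumMap (λ l → δ a (dim (sub l)) ℤ.* ℤΣ.iverson (sub l ==ˢ perp B V)) (allFin m) ℤ.* δ (k ∸ ρ V) r
    entry≡ : ∀ V → Subspace V → entry V ≡ ℤΣ.iverson (contributes a r V)
    entry≡ V subV = begin
        entry V
      ≡⟨ cong (ℤ._* δ (k ∸ ρ V) r) (ℤΣ.sumMap-allFin-lookup (λ W → δ a (dim W) ℤ.* ℤΣ.iverson (W ==ˢ perp B V)) L) ⟩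
        ℤΣ.sumMap (λ W → δ a (dim W) ℤ.* ℤΣ.iverson (W ==ˢ perp B V)) L ℤ.* δ (k ∸ ρ V) r
      ≡⟨ cong (ℤ._* δ (k ∸ ρ V) r) (ℤΣ.sumMap-cong L (λ W → cong (λ b → δ a (dim W) ℤ.* ℤΣ.iverson b) (Mˢ.=ᵇ-sym W (perp B V)))) ⟩
        ℤΣ.sumMap (λ W → δ a (dim W) ℤ.* ℤΣ.iverson (perp B V Mˢ.=ᵇ W)) L ℤ.* δ (k ∸ ρ V) r
      ≡⟨ cong (ℤ._* δ (k ∸ ρ V) r) (Pick.sumMap-pick (Listₚ.≡-dec Boolₚ._≟_) ℤₚ.+-*-commutativeSemiring
                                       (λ W → δ a (dim W)) (perp B V) L (mult-L (perp-subspace V))) ⟩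
        δ a (dim (perp B V)) ℤ.* δ (k ∸ ρ V) r
      ≡⟨ cong (λ d → δ a d ℤ.* δ (k ∸ ρ V) r) (dim-perp V subV) ⟩
        ℤΣ.iverson (a ≡ᵇ n ∸ dim V) ℤ.* ℤΣ.iverson (k ∸ ρ V ≡ᵇ r)
      ≡⟨ cong (λ b → ℤΣ.iverson b ℤ.* ℤΣ.iverson (k ∸ ρ V ≡ᵇ r)) (≡ᵇ-sym a (n ∸ dim V)) ⟩
        ℤΣ.iverson (n ∸ dim V ≡ᵇ a) ℤ.* ℤΣ.iverson (k ∸ ρ V ≡ᵇ r)
      ≡⟨ ℤΣ.iverson-∧ (n ∸ dim V ≡ᵇ a) (k ∸ ρ V ≡ᵇ r) ⟨
        ℤΣ.iverson (contributes a r V) ∎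

  superspaces : Subset → ℕ → ℕ
  superspaces X a = ℕSums.count (λ W → (X ⊆ᵇ W) ∧ (dim W ≡ᵇ a)) L

  superspaces-≤ : ∀ {X} a → Subspace X → dim X ≤ a → superspaces X a ≡ gauss q (n ∸ dim X) (a ∸ dim X)
  superspaces-≤ {X} a subX dX≤a = trans (cong (superspaces X) (sym (ℕₚ.m+[n∸m]≡n dX≤a))) (count-superspaces subX (a ∸ dim X))

  superspaces-≰ : ∀ {X} a → Subspace X → (dim X ≤ᵇ a) ≡ false → superspaces X a ≡ 0
  superspaces-≰ {X} a subX dX≰a = trans (sumMap-L-cong none) (Counting.count-0 (λ _ → false) L (λ _ → refl))
    where
    none : ∀ W → Subspace W → ℕSums.iverson ((X ⊆ᵇ W) ∧ (dim W ≡ᵇ a)) ≡ 0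
    none W subW with X ⊆ᵇ W in X⊆W | dim W ≡ᵇ a in dW≡a
    ... | false | _     = refl
    ... | true  | false = refl
    ... | true  | true  with () ← trans (sym dX≰a) (≤ᵇ-complete (subst (dim X ≤_) (≡ᵇ-sound dW≡a) (dim-mono subX subW (⊆ᵇ-sound X⊆W))))

  -- μ(W,V) for dim W = d and dim V = a, when W ⊆ V.
  μ-value : ℕ → ℕ → ℤ
  μ-value a d = sign (a ∸ d) ℤ.* + (q ^ ((a ∸ d) C 2))

  F-entry : ℕ → ℕ → ℤ
  F-entry a t = if t ≤ᵇ a then μ-value a t ℤ.* + gauss q (n ∸ t) (a ∸ t) else + 0

  F-entry-superspaces : ∀ a {X} → Subspace X → F-entry a (dim X) ≡ μ-value a (dim X) ℤ.* + superspaces X a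
  F-entry-superspaces a {X} subX with dim X ≤ᵇ a in dX≤a
  ... | true  = cong (λ s → μ-value a (dim X) ℤ.* + s) (sym (superspaces-≤ a subX (≤ᵇ-sound dX≤a)))
  ... | false = sym (trans (cong (λ s → μ-value a (dim X) ℤ.* + s) (superspaces-≰ a subX dX≤a)) (ℤₚ.*-zeroʳ (μ-value a (dim X))))

  δ*μ : ∀ a X W → δ a (dim W) ℤ.* μ X W ≡ μ-value a (dim X) ℤ.* ℤΣ.iverson ((X ⊆ᵇ W) ∧ (dim W ≡ᵇ a))
  δ*μ a X W with a ≡ᵇ dim W in a≡dW
  ... | false rewrite ≡ᵇ-sym (dim W) a | a≡dW | Boolₚ.∧-zeroʳ (X ⊆ᵇ W) = sym (ℤₚ.*-zeroʳ (μ-value a (dim X)))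
  ... | true  rewrite sym (≡ᵇ-sound {a} a≡dW) | ≡ᵇ-complete {a} refl with X ⊆ᵇ W
  ...   | true  = trans (ℤₚ.*-identityˡ (μ-value a (dim X))) (sym (ℤₚ.*-identityʳ (μ-value a (dim X))))
  ...   | false = sym (ℤₚ.*-zeroʳ (μ-value a (dim X)))

  FD≡DM : ∀ i V → (Fmat · Dmat) i V ≡ (Dmat · Mmat) i V
  FD≡DM i V = begin
      (Fmat · Dmat) i V
    ≡⟨ ℤΣ.sumMap-cong (allFin (suc n)) (λ l → F*δ (toℕ l)) ⟩
      ℤΣ.sumMap (λ l → if dX ≡ᵇ toℕ l then F-entry a (toℕ l) else + 0) (allFin (suc n))
    ≡⟨ ℤΣ.sumMap-allFin-single (suc n) (F-entry a) dX (s≤s (dim≤n X)) ⟩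
      F-entry a dX
    ≡⟨ F-entry-superspaces a (sub-subspace V) ⟩
      μ-value a dX ℤ.* + superspaces X a
    ≡⟨ cong (μ-value a dX ℤ.*_) (trans (cong +_ (sym (ℕSums.length-filterᵇ _ L))) (+length-filterᵇ _)) ⟩
      μ-value a dX ℤ.* ℤΣ.count (λ W → (X ⊆ᵇ W) ∧ (dim W ≡ᵇ a)) L
    ≡⟨ ℤΣ.*-distribˡ-sumMap (μ-value a dX) _ L ⟩
      ℤΣ.sumMap (λ W → μ-value a dX ℤ.* ℤΣ.iverson ((X ⊆ᵇ W) ∧ (dim W ≡ᵇ a))) L
    ≡⟨ ℤΣ.sumMap-cong L (λ W → sym (δ*μ a X W)) ⟩
      ℤΣ.sumMap (λ W → δ a (dim W) ℤ.* μ X W) L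
    ≡⟨ ℤΣ.sumMap-allFin-lookup (λ W → δ a (dim W) ℤ.* μ X W) L ⟨
      (Dmat · Mmat) i V ∎
    where
    open ≡-Reasoning
    X : Subset
    X = sub V
    a dX : ℕ
    a = toℕ i
    dX = dim X
    F*δ : ∀ t → F-entry a t ℤ.* δ t dX ≡ (if dX ≡ᵇ t then F-entry a t else + 0)
    F*δ t rewrite ≡ᵇ-sym t dX with dX ≡ᵇ t
    ... | true  = ℤₚ.*-identityʳ (F-entry a t)
    ... | false = ℤₚ.*-zeroʳ (F-entry a t)

  module Whitney (R : CommutativeRing 0ℓ 0ℓ) (x y y⁻¹ : CommutativeRing.Carrier R)
                 (y*y⁻¹≈1 : CommutativeRing._≈_ R (CommutativeRing._*_ R y y⁻¹) (CommutativeRing.1# R)) where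

    open CommutativeRing R using (Carrier; _≈_; _+_; _*_; 0#; 1#; commutativeSemiring; *-commutativeSemigroup;
      *-cong; *-congˡ; *-congʳ; *-assoc; *-identityˡ; *-identityʳ; zeroˡ) renaming (refl to ≈-refl; sym to ≈-sym; trans to ≈-trans)
    open Eval R
    open import Relation.Binary.Reasoning.Setoid (CommutativeRing.setoid R)
    open import Algebra.Properties.CommutativeSemigroup *-commutativeSemigroup using (x∙yz≈y∙xz; interchange)
    module RΣ = Sums commutativeSemiring

    ^ᴿ-+ : ∀ a e f → a ^ᴿ (e +ℕ f) ≈ a ^ᴿ e * a ^ᴿ f
    ^ᴿ-+ a zero    f = ≈-sym (*-identityˡ _)
    ^ᴿ-+ a (suc e) f = ≈-trans (*-congˡ (^ᴿ-+ a e f)) (≈-sym (*-assoc a _ _))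

    y^e*y⁻¹^e≈1 : ∀ e → y ^ᴿ e * y⁻¹ ^ᴿ e ≈ 1#
    y^e*y⁻¹^e≈1 zero    = *-identityˡ 1#
    y^e*y⁻¹^e≈1 (suc e) = ≈-trans (interchange y (y ^ᴿ e) y⁻¹ (y⁻¹ ^ᴿ e))
                            (≈-trans (*-cong y*y⁻¹≈1 (y^e*y⁻¹^e≈1 e)) (*-identityˡ 1#))

    y^d*y⁻¹^p≈y^[d-p] : ∀ d p → p ≤ d → y ^ᴿ d * y⁻¹ ^ᴿ p ≈ y ^ᴿ (d ∸ p)
    y^d*y⁻¹^p≈y^[d-p] d p p≤d = begin
      y ^ᴿ d * y⁻¹ ^ᴿ p                            ≡⟨ cong (λ e → y ^ᴿ e * y⁻¹ ^ᴿ p) (sym (ℕₚ.m∸n+n≡m p≤d)) ⟩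
      y ^ᴿ ((d ∸ p) +ℕ p) * y⁻¹ ^ᴿ p               ≈⟨ *-congʳ (^ᴿ-+ y (d ∸ p) p) ⟩
      (y ^ᴿ (d ∸ p) * y ^ᴿ p) * y⁻¹ ^ᴿ p           ≈⟨ *-assoc _ _ _ ⟩
      y ^ᴿ (d ∸ p) * (y ^ᴿ p * y⁻¹ ^ᴿ p)           ≈⟨ *-congˡ (y^e*y⁻¹^e≈1 p) ⟩
      y ^ᴿ (d ∸ p) * 1#                            ≈⟨ *-identityʳ _ ⟩
      y ^ᴿ (d ∸ p)                                 ∎

    monomial : ℕ → ℕ → Carrier
    monomial j i = y ^ᴿ (n ∸ j) * (x ^ᴿ i * y⁻¹ ^ᴿ (k ∸ i))

    weight : Subset → Carrier
    weight V = x ^ᴿ (k ∸ ρ V) * y ^ᴿ (dim V ∸ ρ V)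

    fromℤ-+length-filterᵇ : ∀ p → fromℤ (+ length (filterᵇ p L)) ≈ RΣ.count p L
    fromℤ-+length-filterᵇ p = RΣ.fromℕ-length-filterᵇ (λ m → fromℤ (+ m)) ≈-refl (λ _ → ≈-refl) p L

    term≈ : ∀ J I → y ^ᴿ (n ∸ toℕ J) * (fromℤ ((Nmat ᵀ) J I) * (x ^ᴿ toℕ I * y⁻¹ ^ᴿ (k ∸ toℕ I)))
                    ≈ RΣ.sumMap (λ V → RΣ.iverson (contributes (toℕ J) (toℕ I) V) * monomial (toℕ J) (toℕ I)) L
    term≈ J I = begin
        y ^ᴿ (n ∸ toℕ J) * (fromℤ ((Nmat ᵀ) J I) * (x ^ᴿ toℕ I * y⁻¹ ^ᴿ (k ∸ toℕ I)))
      ≈⟨ x∙yz≈y∙xz _ _ _ ⟩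
        fromℤ (Nmat I J) * monomial (toℕ J) (toℕ I)
      ≡⟨ cong (λ z → fromℤ z * monomial (toℕ J) (toℕ I)) (N-entry I J) ⟩
        fromℤ (+ length (filterᵇ (contributes (toℕ J) (toℕ I)) L)) * monomial (toℕ J) (toℕ I)
      ≈⟨ *-congʳ (fromℤ-+length-filterᵇ _) ⟩
        RΣ.count (contributes (toℕ J) (toℕ I)) L * monomial (toℕ J) (toℕ I)
      ≈⟨ RΣ.*-distribʳ-sumMap _ _ L ⟩
        RΣ.sumMap (λ V → RΣ.iverson (contributes (toℕ J) (toℕ I) V) * monomial (toℕ J) (toℕ I)) L ∎

    per-subspace : ∀ V → Subspace V →
                   RΣ.sumMap (λ J → RΣ.sumMap (λ I → RΣ.iverson (contributes (toℕ J) (toℕ I) V) * monomial (toℕ J) (toℕ I))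
                                              (allFin (suc k))) (allFin (suc n))
                     ≈ weight V
    per-subspace V subV = begin
        RΣ.sumMap (λ J → RΣ.sumMap (λ I → RΣ.iverson (contributes (toℕ J) (toℕ I) V) * monomial (toℕ J) (toℕ I))
                                   (allFin (suc k))) (allFin (suc n))
      ≈⟨ RΣ.sumMap-cong (allFin (suc n)) row ⟩
        RΣ.sumMap (λ J → if a ≡ᵇ toℕ J then monomial (toℕ J) b else 0#) (allFin (suc n))
      ≈⟨ RΣ.sumMap-allFin-single (suc n) (λ j → monomial j b) a (s≤s (ℕₚ.m∸n≤m n (dim V))) ⟩
        y ^ᴿ (n ∸ a) * (x ^ᴿ b * y⁻¹ ^ᴿ (k ∸ b))
      ≡⟨ cong₂ (λ s t → y ^ᴿ s * (x ^ᴿ b * y⁻¹ ^ᴿ t)) (ℕₚ.m∸[m∸n]≡n (dim≤n V)) (ℕₚ.m∸[m∸n]≡n (ρ≤k V subV)) ⟩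
        y ^ᴿ dim V * (x ^ᴿ b * y⁻¹ ^ᴿ ρ V)
      ≈⟨ x∙yz≈y∙xz _ _ _ ⟩
        x ^ᴿ b * (y ^ᴿ dim V * y⁻¹ ^ᴿ ρ V)
      ≈⟨ *-congˡ (y^d*y⁻¹^p≈y^[d-p] (dim V) (ρ V) (ρ≤dim V subV)) ⟩
        weight V ∎
      where
      a b : ℕ
      a = n ∸ dim V
      b = k ∸ ρ V
      row : ∀ J → RΣ.sumMap (λ I → RΣ.iverson (contributes (toℕ J) (toℕ I) V) * monomial (toℕ J) (toℕ I)) (allFin (suc k))
                    ≈ (if a ≡ᵇ toℕ J then monomial (toℕ J) b else 0#)
      row J with a ≡ᵇ toℕ J
      ... | false = RΣ.sumMap-0 (allFin (suc k)) (λ I → zeroˡ _)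
      ... | true  = ≈-trans (RΣ.sumMap-cong (allFin (suc k)) (λ I → RΣ.iverson-* (b ≡ᵇ toℕ I) _))
                            (RΣ.sumMap-allFin-single (suc k) (monomial (toℕ J)) b (s≤s (ℕₚ.m∸n≤m k (ρ V))))

    uNv≈whitney : uNv x y y⁻¹ ≈ whitney x y
    uNv≈whitney = begin
        uNv x y y⁻¹
      ≈⟨ RΣ.sumMap-cong (allFin (suc n)) (λ J → RΣ.sumMap-cong (allFin (suc k)) (term≈ J)) ⟩
        RΣ.sumMap (λ J → RΣ.sumMap (λ I → RΣ.sumMap (f J I) L) (allFin (suc k))) (allFin (suc n))
      ≈⟨ RΣ.sumMap-cong (allFin (suc n)) (λ J → RΣ.sumMap-swap (f J) (allFin (suc k)) L) ⟩
        RΣ.sumMap (λ J → RΣ.sumMap (λ V → RΣ.sumMap (λ I → f J I V) (allFin (suc k))) L) (allFin (suc n))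
      ≈⟨ RΣ.sumMap-swap (λ J V → RΣ.sumMap (λ I → f J I V) (allFin (suc k))) (allFin (suc n)) L ⟩
        RΣ.sumMap (λ V → RΣ.sumMap (λ J → RΣ.sumMap (λ I → f J I V) (allFin (suc k))) (allFin (suc n))) L
      ≈⟨ RΣ.sumMap-cong-filterᵇ isSubspaceᵇ (allSubsets Nₑ) (λ V e → per-subspace V (isSubspaceᵇ⇒Subspace e)) ⟩
        RΣ.sumMap weight L
      ≡⟨ RΣ.sumMap-allFin-lookup weight L ⟨
        whitney x y ∎
      where
      f : Fin (suc n) → Fin (suc k) → Subset → Carrier
      f J I V = RΣ.iverson (contributes (toℕ J) (toℕ I) V) * monomial (toℕ J) (toℕ I)

open Space using (E; Subset; IsNondegSymBilinear; IsQMatroid)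
open Space.Matrices using (Nmat; Dmat; Pmat; Kmat; Fmat; Mmat)
open Space.Matrices.Eval using (uNv; whitney)

proposition4p3 :
    (𝔽 : FiniteField) (n : ℕ)
    (B : E 𝔽 n → E 𝔽 n → FiniteField.Carrier 𝔽) → IsNondegSymBilinear 𝔽 n B →
    (ρ : Subset 𝔽 n → ℕ) → IsQMatroid 𝔽 n ρ →
    -- (a) u N^T v^T = R_M(x,y), as an identity in every commutative ring with y a unit
    ((R : CommutativeRing 0ℓ 0ℓ) (x y y⁻¹ : CommutativeRing.Carrier R) →
       CommutativeRing._≈_ R (CommutativeRing._*_ R y y⁻¹) (CommutativeRing.1# R) →
       CommutativeRing._≈_ R (uNv 𝔽 n B ρ R x y y⁻¹) (whitney 𝔽 n B ρ R x y))
    -- (b) D P K = N^T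
    × (∀ i j → ((Dmat 𝔽 n B ρ · Pmat 𝔽 n B ρ) · Kmat 𝔽 n B ρ) i j ≡ (Nmat 𝔽 n B ρ ᵀ) i j)
    -- (c) F D = D M
    × (∀ i j → (Fmat 𝔽 n B ρ · Dmat 𝔽 n B ρ) i j ≡ (Dmat 𝔽 n B ρ · Mmat 𝔽 n B ρ) i j)
proposition4p3 𝔽 n B bil ρ qm = Whitney.uNv≈whitney , DPK≡Nᵀ , FD≡DM
  where open Proposition 𝔽 n B bil ρ qm
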